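{- Let $s\ge 1$ and let $G_0$ be a bicyclic graph with vertex set $V(G_0)=\{v_1,\dots,v_s\}\cup V(C_p)\cup V(C_q)$, where $C_p$ and $C_q$ are cycles of $G_0$ sharing exactly one common vertex $w$, $u\in V(C_q)$ with $u\ne w$, and $uv_1,\dots,uv_s$ are pendent edges incident with $u$. Let $G_1$ be the graph obtained from $G_0$ by deleting the edges $uv_1,\dots,uv_s$ and adding the edges $wv_1,\dots,wv_s$. Then $D_R(G_0)>D_R(G_1)$.
   Context: All graphs are finite and simple. For vertices $x,y$ of a connected graph $G$, the resistance distance $r(x,y)$ is the effective resistance between $x$ and $y$ in the electrical network obtained from $G$ by replacing every edge by a unit resistor. The degree resistance distance of $G$ is $D_R(G)=\sum_{\{x,y\}\subseteq V(G)}[d(x)+d(y)]\,r(x,y)$, where $d(x)$ is the degree of $x$. A bicyclic graph is a connected graph with $|E(G)|=|V(G)|+1$. A pendent edge is an edge incident with a vertex of degree $1$. -}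

module Defs where

open import Data.Bool using (Bool; true; false; _∧_; _∨_; if_then_else_)
open import Data.Nat as ℕ using (ℕ; zero; suc; _≡ᵇ_; _<ᵇ_; _≤ᵇ_; _∸_)
open import Data.List using (List; upTo; map; foldr)
open import Data.Integer using (+_)
open import Data.Rational using (ℚ; 0ℚ; 1ℚ; _+_; _-_; _*_; _/_)
open import Data.Product using (Σ; _×_)
open import Relation.Binary.PropositionalEquality using (_≡_)

-- Generic finite simple graphs, given by their vertex count n
-- (vertices 0 … n-1) and a decidable adjacency relation.

record Graph : Set where
  field
    size : ℕ
    adj  : ℕ → ℕ → Bool
open Graph public

sumℚ : List ℚ → ℚ
sumℚ = foldr _+_ 0ℚ

Σ[<_]_ : ℕ → (ℕ → ℚ) → ℚ
Σ[< n ] f = sumℚ (map f (upTo n))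

ℕtoℚ : ℕ → ℚ
ℕtoℚ n = (+ n) / 1

countℕ : ℕ → (ℕ → Bool) → ℕ
countℕ n P = foldr (λ y acc → if P y then suc acc else acc) 0 (upTo n)

deg : Graph → ℕ → ℕ
deg G x = countℕ (size G) (adj G x)

δ : ℕ → ℕ → ℚ
δ v x = if v ≡ᵇ x then 1ℚ else 0ℚ

laplacian : Graph → (ℕ → ℚ) → ℕ → ℚ
laplacian G φ v = Σ[< size G ] (λ y → if adj G v y then φ v - φ y else 0ℚ)

-- r is the effective resistance between x and y (unit resistors):
-- there is a potential φ such that a unit current enters at x and leaves
-- at y (Kirchhoff's current law at every vertex, Ohm's law on every edge),
-- and r is the resulting potential difference φ(x) - φ(y).
IsResistance : Graph → ℕ → ℕ → ℚ → Set
IsResistance G x y r =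
  Σ (ℕ → ℚ) λ φ →
    ((v : ℕ) → v ℕ.< size G → laplacian G φ v ≡ δ v x - δ v y)
    × (r ≡ φ x - φ y)

IsResistanceDistance : Graph → (ℕ → ℕ → ℚ) → Set
IsResistanceDistance G R =
  (x y : ℕ) → x ℕ.< size G → y ℕ.< size G → IsResistance G x y (R x y)

degreeResistance : Graph → (ℕ → ℕ → ℚ) → ℚ
degreeResistance G R =
  Σ[< size G ] λ x → Σ[< size G ] λ y →
    if x <ᵇ y then ℕtoℚ (deg G x ℕ.+ deg G y) * R x y else 0ℚ

-- Parameters: p = |C_p|, q = |C_q|, s ≥ 1
-- pendent vertices, and c = the vertex carrying the pendent edges.
-- Labelling:  w = 0;  C_p = 0,1,…,p-1 (in cyclic order);
--   C_q = 0, p, p+1, …, p+q-2 (in cyclic order);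
--   v_1,…,v_s = p+q-1, …, p+q-2+s.

numV : ℕ → ℕ → ℕ → ℕ
numV p q s = (p ℕ.+ q ∸ 1) ℕ.+ s

-- one orientation of each edge (a → b)
edgeDir : ℕ → ℕ → ℕ → ℕ → ℕ → ℕ → Bool
edgeDir p q s c a b =
     ((b ≡ᵇ suc a) ∧ (b <ᵇ p))
  ∨ ((a ≡ᵇ 0) ∧ (b ≡ᵇ p ∸ 1))
  ∨ ((a ≡ᵇ 0) ∧ (b ≡ᵇ p))
  ∨ ((p ≤ᵇ a) ∧ (b ≡ᵇ suc a) ∧ (b ≤ᵇ p ℕ.+ q ∸ 2))
  ∨ ((a ≡ᵇ 0) ∧ (b ≡ᵇ p ℕ.+ q ∸ 2))
  ∨ ((a ≡ᵇ c) ∧ ((p ℕ.+ q ∸ 1) ≤ᵇ b) ∧ (b <ᵇ numV p q s))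

graphWith : ℕ → ℕ → ℕ → ℕ → Graph
graphWith p q s c = record
  { size = numV p q s
  ; adj  = λ a b → edgeDir p q s c a b ∨ edgeDir p q s c b a }

-- u is the k-th vertex of C_q after w (1 ≤ k ≤ q-1): label p+k-1
uVertex : ℕ → ℕ → ℕ
uVertex p k = p ℕ.+ k ∸ 1

G₀ : ℕ → ℕ → ℕ → ℕ → Graph
G₀ p q s k = graphWith p q s (uVertex p k)

G₁ : ℕ → ℕ → ℕ → Graph
G₁ p q s = graphWith p q s 0

-- Resistances are computed from explicit potentials. On a cycle of length m, a unit current
-- entering at position i and leaving at 0 has potential min(i,t) - it/m at position t. Since w
-- is a cut vertex, a unit current from a core vertex to w has this cycle potential on the block
-- of the source and potential 0 on the other block; a pendant vertex takes the potential of its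
-- attachment vertex c, plus 1 if it is the source. Two solutions of Kirchhoff's equations differ
-- by a harmonic function, which is constant on the connected graph (maximum principle).
-- Only the pendant rows and columns of D_R depend on c:
--   D_R(G_c) = B + s * Σ_{x in core} (d_core(x) + 2) * r(c,x),   with B independent of c,
-- and moving the pendants from u, k steps from w on C_q, to w lowers this by s(4p - 2)k(q - k)/q > 0.

module Submission where

open import Defs
open import Data.Nat using (ℕ; _≤_; _<_)
open import Data.Rational using (ℚ)
open import Data.Product using (Σ; _×_)
import Data.Rational as Q

open import Relation.Binary.PropositionalEquality using (sym)
open import Data.Nat using (suc; s≤s; z≤n)
open import Data.Product using (_,_)
open import Data.Rational.Properties using (+-monoʳ-<; *-monoʳ-<-pos; module ≤-Reasoning)

module NatCast where

  open import Data.Nat as ℕ using (ℕ; zero; suc; _∸_; _≤_)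
  import Data.Nat.Properties as ℕ
  import Data.Nat.Coprimality as Coprime
  import Data.Integer as ℤ
  import Data.Integer.Properties as ℤ
  open import Data.Rational using (1ℚ; _+_; _-_; _*_; mkℚ; Positive; NonZero)
  open import Data.Rational.Properties
  open import Data.Rational.Solver using (module +-*-Solver)
  open +-*-Solver
  open import Relation.Binary.PropositionalEquality
  open ≡-Reasoning
  open import Defs

  private
    ℕtoℚ-normal : ∀ n → ℕtoℚ n ≡ mkℚ (ℤ.+ n) 0 (Coprime.sym (Coprime.1-coprimeTo n))
    ℕtoℚ-normal n = normalize-coprime (Coprime.sym (Coprime.1-coprimeTo n))

  ℕtoℚ-suc-positive : ∀ n → Positive (ℕtoℚ (suc n))
  ℕtoℚ-suc-positive n = subst Positive (sym (ℕtoℚ-normal (suc n))) _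

  ℕtoℚ-suc-nonZero : ∀ n → NonZero (ℕtoℚ (suc n))
  ℕtoℚ-suc-nonZero n = subst NonZero (sym (ℕtoℚ-normal (suc n))) _

  ℕtoℚ-suc : ∀ n → ℕtoℚ (suc n) ≡ 1ℚ + ℕtoℚ n
  ℕtoℚ-suc n = begin
    (ℤ.+ suc n) Data.Rational./ 1
      ≡⟨ cong (λ z → (ℤ.+ suc z) Data.Rational./ 1) (sym (ℕ.*-identityʳ n)) ⟩
    (ℤ.+ 1 ℤ.+ ℤ.+ (n ℕ.* 1)) Data.Rational./ 1
      ≡⟨ cong (λ z → (ℤ.+ 1 ℤ.+ z) Data.Rational./ 1) (sym (ℤ.+◃n≡+n (n ℕ.* 1))) ⟩
    1ℚ + mkℚ (ℤ.+ n) 0 (Coprime.sym (Coprime.1-coprimeTo n))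
      ≡⟨ cong (1ℚ +_) (sym (ℕtoℚ-normal n)) ⟩
    1ℚ + ℕtoℚ n ∎

  ℕtoℚ-+ : ∀ m n → ℕtoℚ (m ℕ.+ n) ≡ ℕtoℚ m + ℕtoℚ n
  ℕtoℚ-+ zero n = sym (+-identityˡ (ℕtoℚ n))
  ℕtoℚ-+ (suc m) n = begin
    ℕtoℚ (suc (m ℕ.+ n))     ≡⟨ ℕtoℚ-suc (m ℕ.+ n) ⟩
    1ℚ + ℕtoℚ (m ℕ.+ n)      ≡⟨ cong (1ℚ +_) (ℕtoℚ-+ m n) ⟩
    1ℚ + (ℕtoℚ m + ℕtoℚ n)   ≡⟨ sym (+-assoc 1ℚ (ℕtoℚ m) (ℕtoℚ n)) ⟩
    (1ℚ + ℕtoℚ m) + ℕtoℚ n   ≡⟨ cong (_+ ℕtoℚ n) (sym (ℕtoℚ-suc m)) ⟩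
    ℕtoℚ (suc m) + ℕtoℚ n    ∎

  ℕtoℚ-* : ∀ m n → ℕtoℚ (m ℕ.* n) ≡ ℕtoℚ m * ℕtoℚ n
  ℕtoℚ-* zero n = sym (*-zeroˡ (ℕtoℚ n))
  ℕtoℚ-* (suc m) n = begin
    ℕtoℚ (n ℕ.+ m ℕ.* n)          ≡⟨ ℕtoℚ-+ n (m ℕ.* n) ⟩
    ℕtoℚ n + ℕtoℚ (m ℕ.* n)       ≡⟨ cong (ℕtoℚ n +_) (ℕtoℚ-* m n) ⟩
    ℕtoℚ n + ℕtoℚ m * ℕtoℚ n      ≡⟨ solve 2 (λ a b → a :+ b :* a := (con 1ℚ :+ b) :* a) refl (ℕtoℚ n) (ℕtoℚ m) ⟩
    (1ℚ + ℕtoℚ m) * ℕtoℚ n        ≡⟨ cong (_* ℕtoℚ n) (sym (ℕtoℚ-suc m)) ⟩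
    ℕtoℚ (suc m) * ℕtoℚ n         ∎

  ℕtoℚ-∸ : ∀ m n → n ≤ m → ℕtoℚ (m ∸ n) ≡ ℕtoℚ m - ℕtoℚ n
  ℕtoℚ-∸ m n n≤m = begin
    ℕtoℚ (m ∸ n)                       ≡⟨ solve 2 (λ a b → a := (a :+ b) :- b) refl (ℕtoℚ (m ∸ n)) (ℕtoℚ n) ⟩
    (ℕtoℚ (m ∸ n) + ℕtoℚ n) - ℕtoℚ n   ≡⟨ cong (_- ℕtoℚ n) (sym (ℕtoℚ-+ (m ∸ n) n)) ⟩
    ℕtoℚ (m ∸ n ℕ.+ n) - ℕtoℚ n        ≡⟨ cong (λ z → ℕtoℚ z - ℕtoℚ n) (ℕ.m∸n+n≡m n≤m) ⟩
    ℕtoℚ m - ℕtoℚ n                    ∎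

module FiniteSums where

  open import Data.Bool using (Bool; true; false; if_then_else_; T; _∧_; not)
  open import Data.Bool.Properties using (T-∧; ∧-identityʳ)
  open import Data.List using (List; []; _∷_; map)
  open import Data.List.Relation.Unary.All using (All; []; _∷_)
  open import Data.List.Relation.Unary.Unique.Propositional using (Unique; []; _∷_)
  open import Data.List.Membership.Propositional using (_∈_)
  open import Data.List.Relation.Unary.Any using (here; there)
  open import Function.Bundles using (Equivalence)
  open import Data.Nat as ℕ using (ℕ; zero; suc; _≡ᵇ_; _<_; _⊓_; s≤s; z≤n)
  import Data.Nat.Properties as ℕ
  open import Data.List using (foldr; applyUpTo)
  open import Data.Rational as ℚ using (ℚ; 0ℚ; 1ℚ; _+_; _-_; _*_; -_)
  open import Data.Rational.Properties
  open import Data.Rational.Solver using (module +-*-Solver)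
  open +-*-Solver
  open import Data.Product using (Σ; _×_; _,_)
  open import Data.Sum using (inj₁; inj₂)
  open import Data.Empty using (⊥; ⊥-elim)
  open import Data.Unit using (tt)
  open import Function using (_∘_; id)
  open import Relation.Nullary using (¬_; yes; no)
  open import Relation.Binary.PropositionalEquality
  open ≡-Reasoning
  open import Defs
  open NatCast

  ind : Bool → ℚ → ℚ
  ind b x = if b then x else 0ℚ

  ind-0 : ∀ b → ind b 0ℚ ≡ 0ℚ
  ind-0 true  = refl
  ind-0 false = refl

  T⇒≡true : ∀ {b} → T b → b ≡ true
  T⇒≡true {true} _ = refl

  ¬T⇒≡false : ∀ {b} → ¬ T b → b ≡ false
  ¬T⇒≡false {true}  h = ⊥-elim (h tt)
  ¬T⇒≡false {false} _ = refl

  ≡ᵇ-refl : ∀ n → (n ≡ᵇ n) ≡ true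
  ≡ᵇ-refl n = T⇒≡true (ℕ.≡⇒≡ᵇ n n refl)

  ≢⇒≡ᵇ-false : ∀ {m n} → m ≢ n → (m ≡ᵇ n) ≡ false
  ≢⇒≡ᵇ-false {m} {n} m≢n = ¬T⇒≡false (m≢n ∘ ℕ.≡ᵇ⇒≡ m n)

  private
    Σ-shifted : (ℕ → ℚ) → (ℕ → ℕ) → ℕ → ℚ
    Σ-shifted f g n = sumℚ (map f (applyUpTo g n))

    Σ-shifted-∘ : ∀ f g n → Σ-shifted f g n ≡ Σ-shifted (f ∘ g) id n
    Σ-shifted-∘ f g zero = refl
    Σ-shifted-∘ f g (suc n) =
      cong (f (g 0) +_) (trans (Σ-shifted-∘ f (g ∘ suc) n) (sym (Σ-shifted-∘ (f ∘ g) suc n)))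

  Σ-suc : ∀ n (f : ℕ → ℚ) → Σ[< suc n ] f ≡ f 0 + Σ[< n ] (f ∘ suc)
  Σ-suc n f = cong (f 0 +_) (Σ-shifted-∘ f suc n)

  Σ-cong : ∀ n {f g : ℕ → ℚ} → (∀ i → i < n → f i ≡ g i) → Σ[< n ] f ≡ Σ[< n ] g
  Σ-cong zero    h = refl
  Σ-cong (suc n) {f} {g} h = begin
    Σ[< suc n ] f              ≡⟨ Σ-suc n f ⟩
    f 0 + Σ[< n ] (f ∘ suc)    ≡⟨ cong₂ _+_ (h 0 (s≤s z≤n)) (Σ-cong n (λ i i<n → h (suc i) (s≤s i<n))) ⟩
    g 0 + Σ[< n ] (g ∘ suc)    ≡⟨ sym (Σ-suc n g) ⟩
    Σ[< suc n ] g              ∎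

  Σ-zero : ∀ n → Σ[< n ] (λ _ → 0ℚ) ≡ 0ℚ
  Σ-zero zero    = refl
  Σ-zero (suc n) = trans (Σ-suc n (λ _ → 0ℚ)) (trans (+-identityˡ _) (Σ-zero n))

  Σ-distrib-+ : ∀ n (f g : ℕ → ℚ) → Σ[< n ] (λ i → f i + g i) ≡ Σ[< n ] f + Σ[< n ] g
  Σ-distrib-+ zero    f g = refl
  Σ-distrib-+ (suc n) f g = begin
    Σ[< suc n ] (λ i → f i + g i)
      ≡⟨ Σ-suc n (λ i → f i + g i) ⟩
    (f 0 + g 0) + Σ[< n ] (λ i → f (suc i) + g (suc i))
      ≡⟨ cong ((f 0 + g 0) +_) (Σ-distrib-+ n (f ∘ suc) (g ∘ suc)) ⟩
    (f 0 + g 0) + (Σ[< n ] (f ∘ suc) + Σ[< n ] (g ∘ suc))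
      ≡⟨ solve 4 (λ a b c d → (a :+ b) :+ (c :+ d) := (a :+ c) :+ (b :+ d)) refl
                 (f 0) (g 0) (Σ[< n ] (f ∘ suc)) (Σ[< n ] (g ∘ suc)) ⟩
    (f 0 + Σ[< n ] (f ∘ suc)) + (g 0 + Σ[< n ] (g ∘ suc))
      ≡⟨ sym (cong₂ _+_ (Σ-suc n f) (Σ-suc n g)) ⟩
    Σ[< suc n ] f + Σ[< suc n ] g ∎

  Σ-*ˡ : ∀ n (c : ℚ) (f : ℕ → ℚ) → Σ[< n ] (λ i → c * f i) ≡ c * Σ[< n ] f
  Σ-*ˡ zero    c f = sym (*-zeroʳ c)
  Σ-*ˡ (suc n) c f = begin
    Σ[< suc n ] (λ i → c * f i)                ≡⟨ Σ-suc n (λ i → c * f i) ⟩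
    c * f 0 + Σ[< n ] (λ i → c * f (suc i))    ≡⟨ cong (c * f 0 +_) (Σ-*ˡ n c (f ∘ suc)) ⟩
    c * f 0 + c * Σ[< n ] (f ∘ suc)            ≡⟨ sym (*-distribˡ-+ c (f 0) (Σ[< n ] (f ∘ suc))) ⟩
    c * (f 0 + Σ[< n ] (f ∘ suc))              ≡⟨ cong (c *_) (sym (Σ-suc n f)) ⟩
    c * Σ[< suc n ] f                          ∎

  Σ-distrib-diff : ∀ n (f g : ℕ → ℚ) → Σ[< n ] (λ i → f i - g i) ≡ Σ[< n ] f - Σ[< n ] g
  Σ-distrib-diff n f g = begin
    Σ[< n ] (λ i → f i - g i)                 ≡⟨ Σ-distrib-+ n f (λ i → - g i) ⟩
    Σ[< n ] f + Σ[< n ] (λ i → - g i)         ≡⟨ cong (Σ[< n ] f +_) Σ-neg ⟩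
    Σ[< n ] f - Σ[< n ] g                     ∎
    where
    Σ-neg : Σ[< n ] (λ i → - g i) ≡ - Σ[< n ] g
    Σ-neg = begin
      Σ[< n ] (λ i → - g i)          ≡⟨ Σ-cong n (λ i _ → solve 1 (λ a → :- a := con (- 1ℚ) :* a) refl (g i)) ⟩
      Σ[< n ] (λ i → (- 1ℚ) * g i)   ≡⟨ Σ-*ˡ n (- 1ℚ) g ⟩
      (- 1ℚ) * Σ[< n ] g             ≡⟨ solve 1 (λ a → con (- 1ℚ) :* a := :- a) refl (Σ[< n ] g) ⟩
      - Σ[< n ] g                    ∎

  Σ-const : ∀ n c → Σ[< n ] (λ _ → c) ≡ ℕtoℚ n * c
  Σ-const zero    c = sym (*-zeroˡ c)
  Σ-const (suc n) c = begin
    Σ[< suc n ] (λ _ → c)     ≡⟨ Σ-suc n (λ _ → c) ⟩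
    c + Σ[< n ] (λ _ → c)     ≡⟨ cong (c +_) (Σ-const n c) ⟩
    c + ℕtoℚ n * c            ≡⟨ solve 2 (λ a b → a :+ b :* a := (con 1ℚ :+ b) :* a) refl c (ℕtoℚ n) ⟩
    (1ℚ + ℕtoℚ n) * c         ≡⟨ cong (_* c) (sym (ℕtoℚ-suc n)) ⟩
    ℕtoℚ (suc n) * c          ∎

  Σ-ind : ∀ n b (f : ℕ → ℚ) → Σ[< n ] (λ i → ind b (f i)) ≡ ind b (Σ[< n ] f)
  Σ-ind n true  f = refl
  Σ-ind n false f = Σ-zero n

  Σ-split : ∀ a b (f : ℕ → ℚ) → Σ[< a ℕ.+ b ] f ≡ Σ[< a ] f + Σ[< b ] (λ i → f (a ℕ.+ i))
  Σ-split zero    b f = sym (+-identityˡ (Σ[< b ] f))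
  Σ-split (suc a) b f = begin
    Σ[< suc (a ℕ.+ b) ] f
      ≡⟨ Σ-suc (a ℕ.+ b) f ⟩
    f 0 + Σ[< a ℕ.+ b ] (f ∘ suc)
      ≡⟨ cong (f 0 +_) (Σ-split a b (f ∘ suc)) ⟩
    f 0 + (Σ[< a ] (f ∘ suc) + Σ[< b ] (λ i → f (suc a ℕ.+ i)))
      ≡⟨ sym (+-assoc (f 0) _ _) ⟩
    (f 0 + Σ[< a ] (f ∘ suc)) + Σ[< b ] (λ i → f (suc a ℕ.+ i))
      ≡⟨ cong (_+ Σ[< b ] (λ i → f (suc a ℕ.+ i))) (sym (Σ-suc a f)) ⟩
    Σ[< suc a ] f + Σ[< b ] (λ i → f (suc a ℕ.+ i)) ∎

  Σ-last : ∀ n (f : ℕ → ℚ) → Σ[< suc n ] f ≡ Σ[< n ] f + f n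
  Σ-last n f = begin
    Σ[< suc n ] f                   ≡⟨ cong (λ z → Σ[< z ] f) (ℕ.+-comm 1 n) ⟩
    Σ[< n ℕ.+ 1 ] f                 ≡⟨ Σ-split n 1 f ⟩
    Σ[< n ] f + (f (n ℕ.+ 0) + 0ℚ)  ≡⟨ cong (Σ[< n ] f +_) (trans (+-identityʳ _) (cong f (ℕ.+-identityʳ n))) ⟩
    Σ[< n ] f + f n                 ∎

  Σ-single : ∀ n a (f : ℕ → ℚ) → a < n → (∀ i → i < n → i ≢ a → f i ≡ 0ℚ) → Σ[< n ] f ≡ f a
  Σ-single (suc n) zero f _ h = begin
    Σ[< suc n ] f              ≡⟨ Σ-suc n f ⟩
    f 0 + Σ[< n ] (f ∘ suc)    ≡⟨ cong (f 0 +_) (trans (Σ-cong n (λ i i<n → h (suc i) (s≤s i<n) (λ ()))) (Σ-zero n)) ⟩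
    f 0 + 0ℚ                   ≡⟨ +-identityʳ (f 0) ⟩
    f 0                        ∎
  Σ-single (suc n) (suc a) f (s≤s a<n) h = begin
    Σ[< suc n ] f              ≡⟨ Σ-suc n f ⟩
    f 0 + Σ[< n ] (f ∘ suc)    ≡⟨ cong₂ _+_ (h 0 (s≤s z≤n) (λ ()))
                                            (Σ-single n a (f ∘ suc) a<n (λ i i<n i≢a → h (suc i) (s≤s i<n) (i≢a ∘ ℕ.suc-injective))) ⟩
    0ℚ + f (suc a)             ≡⟨ +-identityˡ (f (suc a)) ⟩
    f (suc a)                  ∎

  Σ-at : ∀ n a (f : ℕ → ℚ) → a < n → Σ[< n ] (λ y → ind (y ≡ᵇ a) (f y)) ≡ f a
  Σ-at n a f a<n =
    trans (Σ-single n a _ a<n (λ i _ i≢a → cong (λ b → ind b (f i)) (≢⇒≡ᵇ-false i≢a)))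
          (cong (λ b → ind b (f a)) (≡ᵇ-refl a))

  Σ-support : ∀ n (A : ℕ → Bool) (f : ℕ → ℚ) (xs : List ℕ) → Unique xs → All (_< n) xs → All (T ∘ A) xs →
              (∀ y → y < n → T (A y) → y ∈ xs) → Σ[< n ] (λ y → ind (A y) (f y)) ≡ sumℚ (map f xs)
  Σ-support n A f [] _ _ _ supp =
    trans (Σ-cong n (λ y y<n → cong (λ b → ind b (f y)) (¬T⇒≡false (λ t → ∉[] (supp y y<n t))))) (Σ-zero n)
    where
    ∉[] : ∀ {y} → y ∈ [] → ⊥
    ∉[] ()
  Σ-support n A f (x ∷ xs) (x∉xs ∷ xs-unique) (x<n ∷ xs<n) (Ax ∷ Axs) supp = begin
    Σ[< n ] (λ y → ind (A y) (f y))
      ≡⟨ Σ-cong n split ⟩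
    Σ[< n ] (λ y → ind (y ≡ᵇ x) (f y) + ind (A′ y) (f y))
      ≡⟨ Σ-distrib-+ n _ _ ⟩
    Σ[< n ] (λ y → ind (y ≡ᵇ x) (f y)) + Σ[< n ] (λ y → ind (A′ y) (f y))
      ≡⟨ cong₂ _+_ (Σ-at n x f x<n) (Σ-support n A′ f xs xs-unique xs<n (A′-all Axs x∉xs) supp′) ⟩
    f x + sumℚ (map f xs) ∎
    where
    A′ : ℕ → Bool
    A′ y = A y ∧ not (y ≡ᵇ x)
    split : ∀ y → y < n → ind (A y) (f y) ≡ ind (y ≡ᵇ x) (f y) + ind (A′ y) (f y)
    split y _ with y ℕ.≟ x
    ... | yes refl rewrite T⇒≡true Ax | ≡ᵇ-refl y = sym (+-identityʳ (f y))
    ... | no y≢x rewrite ≢⇒≡ᵇ-false y≢x | ∧-identityʳ (A y) = sym (+-identityˡ (ind (A y) (f y)))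
    A′-all : ∀ {zs} → All (T ∘ A) zs → All (x ≢_) zs → All (T ∘ A′) zs
    A′-all [] [] = []
    A′-all {z ∷ _} (Az ∷ Azs) (x≢z ∷ x∉zs) = A′-at ∷ A′-all Azs x∉zs
      where
      A′-at : T (A′ z)
      A′-at rewrite T⇒≡true Az | ≢⇒≡ᵇ-false (x≢z ∘ sym) = tt
    supp′ : ∀ y → y < n → T (A′ y) → y ∈ xs
    supp′ y y<n t with Equivalence.to T-∧ t
    ... | Ay , y≢ᵇx with supp y y<n Ay
    ...   | here y≡x = ⊥-elim (subst (λ b → T (not b)) (T⇒≡true (ℕ.≡⇒≡ᵇ y x y≡x)) y≢ᵇx)
    ...   | there y∈xs = y∈xs

  Σ-nonneg : ∀ n (f : ℕ → ℚ) → (∀ i → i < n → 0ℚ ℚ.≤ f i) → 0ℚ ℚ.≤ Σ[< n ] f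
  Σ-nonneg zero    f h = ≤-refl
  Σ-nonneg (suc n) f h = subst (0ℚ ℚ.≤_) (sym (Σ-suc n f))
    (+-mono-≤ (h 0 (s≤s z≤n)) (Σ-nonneg n (f ∘ suc) (λ i i<n → h (suc i) (s≤s i<n))))

  Σ-nonneg-≡0 : ∀ n (f : ℕ → ℚ) → (∀ i → i < n → 0ℚ ℚ.≤ f i) → Σ[< n ] f ≡ 0ℚ → ∀ i → i < n → f i ≡ 0ℚ
  Σ-nonneg-≡0 (suc n) f h Σ≡0 i i<n = go i i<n
    where
    h₀ = h 0 (s≤s z≤n)
    hₛ : ∀ j → j < n → 0ℚ ℚ.≤ f (suc j)
    hₛ j j<n = h (suc j) (s≤s j<n)
    nonneg-+≡0 : ∀ a b → 0ℚ ℚ.≤ a → 0ℚ ℚ.≤ b → a + b ≡ 0ℚ → a ≡ 0ℚ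
    nonneg-+≡0 a b 0≤a 0≤b a+b≡0 =
      ≤-antisym (subst₂ ℚ._≤_ (+-identityʳ a) a+b≡0 (+-monoʳ-≤ a 0≤b)) 0≤a
    go : ∀ i → i < suc n → f i ≡ 0ℚ
    go zero    _ = nonneg-+≡0 _ _ h₀ (Σ-nonneg n (f ∘ suc) hₛ) (trans (sym (Σ-suc n f)) Σ≡0)
    go (suc i) (s≤s i<n) = Σ-nonneg-≡0 n (f ∘ suc) hₛ
      (nonneg-+≡0 _ _ (Σ-nonneg n (f ∘ suc) hₛ) h₀ (trans (+-comm _ (f 0)) (trans (sym (Σ-suc n f)) Σ≡0))) i i<n

  Σ-count : ∀ n (P : ℕ → Bool) → ℕtoℚ (countℕ n P) ≡ Σ[< n ] (λ y → ind (P y) 1ℚ)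
  Σ-count zero    P = refl
  Σ-count (suc n) P = trans count-suc (sym (Σ-suc n (λ y → ind (P y) 1ℚ)))
    where
    step : (ℕ → Bool) → ℕ → ℕ → ℕ
    step P y acc = if P y then suc acc else acc
    countFrom : (ℕ → Bool) → (ℕ → ℕ) → ℕ → ℕ
    countFrom P g n = foldr (step P) 0 (applyUpTo g n)
    countFrom-∘ : ∀ P g n → countFrom P g n ≡ countFrom (P ∘ g) id n
    countFrom-∘ P g zero = refl
    countFrom-∘ P g (suc n) with P (g 0)
    ... | true  = cong suc (trans (countFrom-∘ P (g ∘ suc) n) (sym (countFrom-∘ (P ∘ g) suc n)))
    ... | false = trans (countFrom-∘ P (g ∘ suc) n) (sym (countFrom-∘ (P ∘ g) suc n))
    shift : countℕ n (P ∘ suc) ≡ countFrom P suc n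
    shift = sym (countFrom-∘ P suc n)
    count-suc : ℕtoℚ (countFrom P id (suc n)) ≡ ind (P 0) 1ℚ + Σ[< n ] (λ y → ind (P (suc y)) 1ℚ)
    count-suc with P 0
    ... | true  = trans (cong (ℕtoℚ ∘ suc) (sym shift))
                        (trans (ℕtoℚ-suc (countℕ n (P ∘ suc))) (cong (1ℚ +_) (Σ-count n (P ∘ suc))))
    ... | false = trans (cong ℕtoℚ (sym shift))
                        (trans (Σ-count n (P ∘ suc)) (sym (+-identityˡ (Σ[< n ] (λ y → ind (P (suc y)) 1ℚ)))))

  argmax : ∀ {n} (f : ℕ → ℚ) → 0 < n → Σ ℕ (λ m → m < n × (∀ i → i < n → f i ℚ.≤ f m))
  argmax {suc n} f _ = argmax-suc n f
    where
    argmax-suc : ∀ n (f : ℕ → ℚ) → Σ ℕ (λ m → m < suc n × (∀ i → i < suc n → f i ℚ.≤ f m))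
    argmax-suc zero f = 0 , s≤s z≤n , λ { zero _ → ≤-refl ; (suc i) (s≤s ()) }
    argmax-suc (suc n) f with argmax-suc n f
    ... | m , m<1+n , f≤fm with ≤-total (f m) (f (suc n))
    ...   | inj₁ fm≤ = suc n , ℕ.≤-refl , bound
      where
      bound : ∀ i → i < suc (suc n) → f i ℚ.≤ f (suc n)
      bound i i< with ℕ.m≤n⇒m<n∨m≡n (ℕ.≤-pred i<)
      ... | inj₁ i<1+n = ≤-trans (f≤fm i i<1+n) fm≤
      ... | inj₂ refl  = ≤-refl
    ...   | inj₂ fm≥ = m , ℕ.m≤n⇒m≤1+n m<1+n , bound
      where
      bound : ∀ i → i < suc (suc n) → f i ℚ.≤ f m
      bound i (s≤s i≤) with ℕ.m≤n⇒m<n∨m≡n i≤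
      ... | inj₁ i<1+n = f≤fm i i<1+n
      ... | inj₂ refl  = fm≥

  Σ-triangular : ∀ m → ℕtoℚ 2 * Σ[< m ] (λ j → ℕtoℚ (suc j)) ≡ ℕtoℚ m * ℕtoℚ (suc m)
  Σ-triangular zero    = refl
  Σ-triangular (suc m) = begin
    ℕtoℚ 2 * Σ[< suc m ] (λ j → ℕtoℚ (suc j))
      ≡⟨ cong (ℕtoℚ 2 *_) (Σ-last m (λ j → ℕtoℚ (suc j))) ⟩
    ℕtoℚ 2 * (Σ[< m ] (λ j → ℕtoℚ (suc j)) + ℕtoℚ (suc m))
      ≡⟨ *-distribˡ-+ (ℕtoℚ 2) (Σ[< m ] (λ j → ℕtoℚ (suc j))) (ℕtoℚ (suc m)) ⟩
    ℕtoℚ 2 * Σ[< m ] (λ j → ℕtoℚ (suc j)) + ℕtoℚ 2 * ℕtoℚ (suc m)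
      ≡⟨ cong (_+ ℕtoℚ 2 * ℕtoℚ (suc m)) (Σ-triangular m) ⟩
    ℕtoℚ m * ℕtoℚ (suc m) + ℕtoℚ 2 * ℕtoℚ (suc m)
      ≡⟨ cong (λ a → ℕtoℚ m * a + ℕtoℚ 2 * a) (ℕtoℚ-suc m) ⟩
    ℕtoℚ m * (1ℚ + ℕtoℚ m) + ℕtoℚ 2 * (1ℚ + ℕtoℚ m)
      ≡⟨ solve 1 (λ x → x :* (con 1ℚ :+ x) :+ con (ℕtoℚ 2) :* (con 1ℚ :+ x)
                      := (con 1ℚ :+ x) :* (con 1ℚ :+ (con 1ℚ :+ x))) refl (ℕtoℚ m) ⟩
    (1ℚ + ℕtoℚ m) * (1ℚ + (1ℚ + ℕtoℚ m))
      ≡⟨ sym (cong₂ _*_ (ℕtoℚ-suc m) (trans (ℕtoℚ-suc (suc m)) (cong (1ℚ +_) (ℕtoℚ-suc m)))) ⟩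
    ℕtoℚ (suc m) * ℕtoℚ (suc (suc m)) ∎

  Σ-⊓ : ∀ k d → Σ[< k ℕ.+ d ] (λ j → ℕtoℚ (k ⊓ suc j)) ≡ Σ[< k ] (λ j → ℕtoℚ (suc j)) + ℕtoℚ d * ℕtoℚ k
  Σ-⊓ k d = trans (Σ-split k d (λ j → ℕtoℚ (k ⊓ suc j)))
    (cong₂ _+_ (Σ-cong k (λ j j<k → cong ℕtoℚ (ℕ.m≥n⇒m⊓n≡n j<k)))
               (trans (Σ-cong d (λ j _ → cong ℕtoℚ (ℕ.m≤n⇒m⊓n≡m (ℕ.≤-trans (ℕ.m≤m+n k j) (ℕ.n≤1+n (k ℕ.+ j))))))
                      (Σ-const d (ℕtoℚ k))))

module Resistance where

  open import Data.Bool using (true; false; T; if_then_else_)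
  open import Data.Nat as ℕ using (ℕ; _<_; _<ᵇ_; s≤s; z≤n)
  import Data.Nat.Properties as ℕ
  open import Data.Rational as ℚ using (ℚ; 0ℚ; _+_; _-_; _*_)
  open import Data.Rational.Properties
  open import Data.Rational.Solver using (module +-*-Solver)
  open +-*-Solver
  open import Data.Product using (_,_; proj₁; proj₂)
  open import Relation.Binary.PropositionalEquality
  open ≡-Reasoning
  open import Defs
  open FiniteSums

  Closed : Graph → (ℕ → Set) → Set
  Closed G S = ∀ a b → a < size G → b < size G → T (adj G a b) → S a → S b

  Connected : Graph → Set₁
  Connected G = ∀ S → Closed G S → ∀ a b → a < size G → b < size G → S a → S b

  Harmonic : Graph → (ℕ → ℚ) → Set
  Harmonic G g = ∀ v → v < size G → laplacian G g v ≡ 0ℚ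

  laplacian-+ : ∀ G (φ ψ : ℕ → ℚ) v → laplacian G (λ z → φ z + ψ z) v ≡ laplacian G φ v + laplacian G ψ v
  laplacian-+ G φ ψ v = trans (Σ-cong (size G) pointwise) (Σ-distrib-+ (size G) _ _)
    where
    pointwise : ∀ y → y < size G → (if adj G v y then (φ v + ψ v) - (φ y + ψ y) else 0ℚ)
                ≡ (if adj G v y then φ v - φ y else 0ℚ) + (if adj G v y then ψ v - ψ y else 0ℚ)
    pointwise y _ with adj G v y
    ... | true  = solve 4 (λ a b c d → (a :+ b) :- (c :+ d) := (a :- c) :+ (b :- d)) refl (φ v) (ψ v) (φ y) (ψ y)
    ... | false = refl

  laplacian-diff : ∀ G (φ ψ : ℕ → ℚ) v → laplacian G (λ z → φ z - ψ z) v ≡ laplacian G φ v - laplacian G ψ v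
  laplacian-diff G φ ψ v = trans (Σ-cong (size G) pointwise) (Σ-distrib-diff (size G) _ _)
    where
    pointwise : ∀ y → y < size G → (if adj G v y then (φ v - ψ v) - (φ y - ψ y) else 0ℚ)
                ≡ (if adj G v y then φ v - φ y else 0ℚ) - (if adj G v y then ψ v - ψ y else 0ℚ)
    pointwise y _ with adj G v y
    ... | true  = solve 4 (λ a b c d → (a :- b) :- (c :- d) := (a :- c) :- (b :- d)) refl (φ v) (ψ v) (φ y) (ψ y)
    ... | false = refl

  -- Maximum principle: at a maximum every term of the vanishing Laplacian is ≥ 0, hence = 0.
  harmonic-max-closed : ∀ G g → Harmonic G g → ∀ m → (∀ y → y < size G → g y ℚ.≤ g m) →
                        Closed G (λ z → g z ≡ g m)
  harmonic-max-closed G g harmonic m g≤gm a b a<n b<n a~b ga≡gm = begin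
    g b                       ≡⟨ solve 2 (λ x y → y := x :- (x :- y)) refl (g a) (g b) ⟩
    g a - (g a - g b)         ≡⟨ cong (g a -_) term-b≡0 ⟩
    g a - 0ℚ                  ≡⟨ solve 1 (λ x → x :- con 0ℚ := x) refl (g a) ⟩
    g a                       ≡⟨ ga≡gm ⟩
    g m                       ∎
    where
    term : ℕ → ℚ
    term y = ind (adj G a y) (g a - g y)
    term-nonneg : ∀ y → y < size G → 0ℚ ℚ.≤ term y
    term-nonneg y y<n with adj G a y
    ... | true  = subst (ℚ._≤ g a - g y) (+-inverseʳ (g y))
                    (+-monoˡ-≤ (ℚ.- g y) (subst (g y ℚ.≤_) (sym ga≡gm) (g≤gm y y<n)))
    ... | false = ≤-refl
    term-b≡0 : g a - g b ≡ 0ℚ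
    term-b≡0 = trans (cong (λ c → ind c (g a - g b)) (sym (T⇒≡true a~b)))
                     (Σ-nonneg-≡0 (size G) term term-nonneg (harmonic a a<n) b b<n)

  harmonic-constant : ∀ G → Connected G → ∀ g → Harmonic G g →
                      ∀ a b → a < size G → b < size G → g a ≡ g b
  harmonic-constant G connected g harmonic a b a<n b<n = trans (at a a<n) (sym (at b b<n))
    where
    max = argmax g (ℕ.<-≤-trans (s≤s z≤n) a<n)
    m = proj₁ max
    at : ∀ z → z < size G → g z ≡ g m
    at z z<n = connected _ (harmonic-max-closed G g harmonic m (proj₂ (proj₂ max)))
                 m z (proj₁ (proj₂ max)) z<n refl

  resistance-unique : ∀ G → Connected G → ∀ {x y r r′} → x < size G → y < size G →
                      IsResistance G x y r → IsResistance G x y r′ → r ≡ r′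
  resistance-unique G connected {x} {y} {r} {r′} x<n y<n (φ , Lφ , r≡) (φ′ , Lφ′ , r′≡) = begin
    r                              ≡⟨ r≡ ⟩
    φ x - φ y                      ≡⟨ solve 4 (λ a b c d → a :- b := ((a :- c) :- (b :- d)) :+ (c :- d)) refl (φ x) (φ y) (φ′ x) (φ′ y) ⟩
    (g x - g y) + (φ′ x - φ′ y)    ≡⟨ cong (λ z → (z - g y) + (φ′ x - φ′ y)) (harmonic-constant G connected g g-harmonic x y x<n y<n) ⟩
    (g y - g y) + (φ′ x - φ′ y)    ≡⟨ solve 3 (λ a b c → (a :- a) :+ (b :- c) := b :- c) refl (g y) (φ′ x) (φ′ y) ⟩
    φ′ x - φ′ y                    ≡⟨ sym r′≡ ⟩
    r′                             ∎
    where
    g : ℕ → ℚ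
    g z = φ z - φ′ z
    g-harmonic : Harmonic G g
    g-harmonic v v<n = trans (laplacian-diff G φ φ′ v)
      (trans (cong₂ _-_ (Lφ v v<n) (Lφ′ v v<n)) (solve 1 (λ a → a :- a := con 0ℚ) refl (δ v x - δ v y)))

  degreeResistance-unique : ∀ G → Connected G → ∀ {R R′} → IsResistanceDistance G R → IsResistanceDistance G R′ →
                            degreeResistance G R ≡ degreeResistance G R′
  degreeResistance-unique G connected isR isR′ =
    Σ-cong (size G) λ x x<n → Σ-cong (size G) λ y y<n →
      cong (λ r → if x <ᵇ y then ℕtoℚ (deg G x ℕ.+ deg G y) * r else 0ℚ)
           (resistance-unique G connected x<n y<n (isR x y x<n y<n) (isR′ x y x<n y<n))

module CycleGreen where

  open import Data.Nat as ℕ using (ℕ; zero; suc; _∸_; _≤_; _<_; _≡ᵇ_; _⊓_)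
  import Data.Nat.Properties as ℕ
  open import Data.Rational using (ℚ; 0ℚ; 1ℚ; _+_; _-_; _*_)
  open import Data.Rational.Properties using (*-comm)
  open import Data.Rational.Solver using (module +-*-Solver)
  open +-*-Solver
  open import Relation.Binary.PropositionalEquality
  open ≡-Reasoning
  open import Defs
  open NatCast
  open FiniteSums using (ind)

  -- With m⁻¹ = 1/m, this is the potential at position t of the cycle 0,1,…,m-1,0
  -- when a unit current enters at position i and leaves at 0.
  cycleGreen : (m⁻¹ : ℚ) → ℕ → ℕ → ℚ
  cycleGreen m⁻¹ i t = ℕtoℚ (i ⊓ t) - ℕtoℚ i * ℕtoℚ t * m⁻¹

  cycleGreen-sym : ∀ m⁻¹ i t → cycleGreen m⁻¹ i t ≡ cycleGreen m⁻¹ t i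
  cycleGreen-sym m⁻¹ i t = cong₂ (λ u v → ℕtoℚ u - v * m⁻¹) (ℕ.⊓-comm i t) (*-comm (ℕtoℚ i) (ℕtoℚ t))

  cycleGreen-0ˡ : ∀ m⁻¹ t → cycleGreen m⁻¹ 0 t ≡ 0ℚ
  cycleGreen-0ˡ m⁻¹ t = solve 2 (λ T v → con 0ℚ :- con 0ℚ :* T :* v := con 0ℚ) refl (ℕtoℚ t) m⁻¹

  cycleGreen-0ʳ : ∀ m⁻¹ i → cycleGreen m⁻¹ i 0 ≡ 0ℚ
  cycleGreen-0ʳ m⁻¹ i = trans (cycleGreen-sym m⁻¹ i 0) (cycleGreen-0ˡ m⁻¹ i)

  cycleGreen-m : ∀ {m⁻¹} m i → ℕtoℚ m * m⁻¹ ≡ 1ℚ → i ≤ m → cycleGreen m⁻¹ i m ≡ 0ℚ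
  cycleGreen-m {m⁻¹} m i m*m⁻¹≡1 i≤m = begin
    ℕtoℚ (i ⊓ m) - I * ℕtoℚ m * m⁻¹   ≡⟨ cong (λ z → ℕtoℚ z - I * ℕtoℚ m * m⁻¹) (ℕ.m≤n⇒m⊓n≡m i≤m) ⟩
    I - I * ℕtoℚ m * m⁻¹              ≡⟨ solve 3 (λ a b c → a :- a :* b :* c := a :- a :* (b :* c)) refl I (ℕtoℚ m) m⁻¹ ⟩
    I - I * (ℕtoℚ m * m⁻¹)            ≡⟨ cong (λ z → I - I * z) m*m⁻¹≡1 ⟩
    I - I * 1ℚ                        ≡⟨ solve 1 (λ a → a :- a :* con 1ℚ := con 0ℚ) refl I ⟩
    0ℚ                                ∎
    where I = ℕtoℚ i

  private
    ⊓-second-difference : ∀ i t → (ℕtoℚ (i ⊓ suc t) - ℕtoℚ (i ⊓ t)) + (ℕtoℚ (i ⊓ suc t) - ℕtoℚ (i ⊓ suc (suc t)))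
                                  ≡ ind (suc t ≡ᵇ i) 1ℚ
    ⊓-second-difference zero t = refl
    ⊓-second-difference (suc zero) zero = refl
    ⊓-second-difference (suc (suc zero)) zero = refl
    ⊓-second-difference (suc (suc (suc i))) zero = refl
    ⊓-second-difference (suc i) (suc t) = begin
      (ℕtoℚ (suc a) - ℕtoℚ (suc b)) + (ℕtoℚ (suc a) - ℕtoℚ (suc c))
        ≡⟨ cong₂ (λ u v → (u - v) + (u - ℕtoℚ (suc c))) (ℕtoℚ-suc a) (ℕtoℚ-suc b) ⟩
      ((1ℚ + ℕtoℚ a) - (1ℚ + ℕtoℚ b)) + ((1ℚ + ℕtoℚ a) - ℕtoℚ (suc c))
        ≡⟨ cong (λ v → ((1ℚ + ℕtoℚ a) - (1ℚ + ℕtoℚ b)) + ((1ℚ + ℕtoℚ a) - v)) (ℕtoℚ-suc c) ⟩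
      ((1ℚ + ℕtoℚ a) - (1ℚ + ℕtoℚ b)) + ((1ℚ + ℕtoℚ a) - (1ℚ + ℕtoℚ c))
        ≡⟨ solve 3 (λ x y z → ((con 1ℚ :+ x) :- (con 1ℚ :+ y)) :+ ((con 1ℚ :+ x) :- (con 1ℚ :+ z))
                             := (x :- y) :+ (x :- z)) refl (ℕtoℚ a) (ℕtoℚ b) (ℕtoℚ c) ⟩
      (ℕtoℚ a - ℕtoℚ b) + (ℕtoℚ a - ℕtoℚ c)
        ≡⟨ ⊓-second-difference i t ⟩
      ind (suc t ≡ᵇ i) 1ℚ ∎
      where
      a = i ⊓ suc t
      b = i ⊓ t
      c = i ⊓ suc (suc t)

  -- The linear part it/m has vanishing second difference, so only the kink of min(i,-) at i remains.
  cycleGreen-second-difference : ∀ m⁻¹ i t →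
      (cycleGreen m⁻¹ i (suc t) - cycleGreen m⁻¹ i t) + (cycleGreen m⁻¹ i (suc t) - cycleGreen m⁻¹ i (suc (suc t)))
      ≡ ind (suc t ≡ᵇ i) 1ℚ
  cycleGreen-second-difference m⁻¹ i t = begin
    (a - I * ℕtoℚ (suc t) * m⁻¹ - (b - I * T * m⁻¹)) + (a - I * ℕtoℚ (suc t) * m⁻¹ - (c - I * ℕtoℚ (suc (suc t)) * m⁻¹))
      ≡⟨ cong₂ (λ u v → (a - I * u * m⁻¹ - (b - I * T * m⁻¹)) + (a - I * u * m⁻¹ - (c - I * v * m⁻¹)))
               (ℕtoℚ-suc t) (trans (ℕtoℚ-suc (suc t)) (cong (1ℚ +_) (ℕtoℚ-suc t))) ⟩
    (a - I * (1ℚ + T) * m⁻¹ - (b - I * T * m⁻¹)) + (a - I * (1ℚ + T) * m⁻¹ - (c - I * (1ℚ + (1ℚ + T)) * m⁻¹))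
      ≡⟨ solve 6 (λ a b c I T v → (a :- I :* (con 1ℚ :+ T) :* v :- (b :- I :* T :* v))
                                 :+ (a :- I :* (con 1ℚ :+ T) :* v :- (c :- I :* (con 1ℚ :+ (con 1ℚ :+ T)) :* v))
                               := (a :- b) :+ (a :- c)) refl a b c I T m⁻¹ ⟩
    (a - b) + (a - c)
      ≡⟨ ⊓-second-difference i t ⟩
    ind (suc t ≡ᵇ i) 1ℚ ∎
    where
    a = ℕtoℚ (i ⊓ suc t)
    b = ℕtoℚ (i ⊓ t)
    c = ℕtoℚ (i ⊓ suc (suc t))
    I = ℕtoℚ i
    T = ℕtoℚ t

  cycleGreen-ends : ∀ {m⁻¹} m i → ℕtoℚ m * m⁻¹ ≡ 1ℚ → 1 ≤ i → i < m →
                    cycleGreen m⁻¹ i 1 + cycleGreen m⁻¹ i (m ∸ 1) ≡ 1ℚ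
  cycleGreen-ends {m⁻¹} m i m*m⁻¹≡1 1≤i i<m = begin
    (ℕtoℚ (i ⊓ 1) - I * ℕtoℚ 1 * m⁻¹) + (ℕtoℚ (i ⊓ (m ∸ 1)) - I * ℕtoℚ (m ∸ 1) * m⁻¹)
      ≡⟨ cong₂ (λ u v → (ℕtoℚ u - I * 1ℚ * m⁻¹) + (ℕtoℚ v - I * ℕtoℚ (m ∸ 1) * m⁻¹))
               (ℕ.m≥n⇒m⊓n≡n 1≤i) (ℕ.m≤n⇒m⊓n≡m (subst (i ≤_) (ℕ.pred[m∸n]≡m∸[1+n] m 0) (ℕ.<⇒≤pred i<m))) ⟩
    (1ℚ - I * 1ℚ * m⁻¹) + (I - I * ℕtoℚ (m ∸ 1) * m⁻¹)
      ≡⟨ cong (λ v → (1ℚ - I * 1ℚ * m⁻¹) + (I - I * v * m⁻¹)) (ℕtoℚ-∸ m 1 1≤m) ⟩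
    (1ℚ - I * 1ℚ * m⁻¹) + (I - I * (ℕtoℚ m - 1ℚ) * m⁻¹)
      ≡⟨ solve 3 (λ I M v → (con 1ℚ :- I :* con 1ℚ :* v) :+ (I :- I :* (M :- con 1ℚ) :* v)
                           := con 1ℚ :+ I :- I :* (M :* v)) refl I (ℕtoℚ m) m⁻¹ ⟩
    1ℚ + I - I * (ℕtoℚ m * m⁻¹)
      ≡⟨ cong (λ v → 1ℚ + I - I * v) m*m⁻¹≡1 ⟩
    1ℚ + I - I * 1ℚ
      ≡⟨ solve 1 (λ I → con 1ℚ :+ I :- I :* con 1ℚ := con 1ℚ) refl I ⟩
    1ℚ ∎
    where
    I = ℕtoℚ i
    1≤m = ℕ.≤-trans 1≤i (ℕ.<⇒≤ i<m)

module BicyclicGraph (p' q' s c : ℕ) where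

  open import Data.Bool using (Bool; _∧_; _∨_; T; if_then_else_)
  open import Data.Bool.Properties using (T-∧; T-∨)
  open import Data.Nat as ℕ using (ℕ; zero; suc; _∸_; _≤_; _<_; z≤n; s≤s; _≡ᵇ_; _<ᵇ_; _≤ᵇ_)
  import Data.Nat.Properties as ℕ
  open import Data.List using ([]; _∷_)
  open import Data.List.Relation.Unary.All using ([]; _∷_)
  open import Data.List.Relation.Unary.Unique.Propositional using ([]; _∷_)
  open import Data.List.Membership.Propositional using (_∈_)
  open import Data.List.Relation.Unary.Any using (here; there)
  open import Data.Rational using (ℚ; 0ℚ; 1ℚ; _+_)
  open import Data.Rational.Properties using (+-identityʳ; *-identityʳ)
  open import Data.Rational.Solver using (module +-*-Solver)
  open +-*-Solver
  open import Data.Product using (_×_; _,_; proj₁; proj₂)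
  open import Data.Sum using (_⊎_; inj₁; inj₂)
  open import Data.Empty using (⊥-elim)
  open import Function.Bundles using (Equivalence)
  open import Relation.Nullary using (yes; no)
  open import Function using (_∘_; id)
  open import Relation.Binary.Definitions using (tri<; tri≈; tri>)
  open import Relation.Binary.PropositionalEquality
  open import Defs
  open FiniteSums
  open Resistance using (Connected)

  p q N M n : ℕ
  p = suc (suc (suc p'))
  q = suc (suc (suc q'))
  N = p ℕ.+ q ∸ 1
  M = p ℕ.+ q ∸ 2
  n = numV p q s

  Gr : Graph
  Gr = graphWith p q s c

  data Edge (a b : ℕ) : Set where
    p-path  : b ≡ suc a → b < p → Edge a b
    p-close : a ≡ 0 → b ≡ p ∸ 1 → Edge a b
    q-open  : a ≡ 0 → b ≡ p → Edge a b
    q-path  : p ≤ a → b ≡ suc a → b ≤ M → Edge a b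
    q-close : a ≡ 0 → b ≡ M → Edge a b
    pendant : a ≡ c → N ≤ b → b < n → Edge a b

  Adjacent : ℕ → ℕ → Set
  Adjacent a b = Edge a b ⊎ Edge b a

  Adjacent-sym : ∀ {a b} → Adjacent a b → Adjacent b a
  Adjacent-sym (inj₁ e) = inj₂ e
  Adjacent-sym (inj₂ e) = inj₁ e

  private
    T∨ : ∀ {x y} → T (x ∨ y) → T x ⊎ T y
    T∨ = Equivalence.to T-∨
    T∧ : ∀ {x y} → T (x ∧ y) → T x × T y
    T∧ = Equivalence.to T-∧
    T∨ˡ : ∀ {x} y → T x → T (x ∨ y)
    T∨ˡ _ t = Equivalence.from T-∨ (inj₁ t)
    T∨ʳ : ∀ x {y} → T y → T (x ∨ y)
    T∨ʳ _ t = Equivalence.from T-∨ (inj₂ t)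
    T∧-intro : ∀ {x y} → T x → T y → T (x ∧ y)
    T∧-intro a b = Equivalence.from T-∧ (a , b)

    edgeDir⇒Edge : ∀ a b → T (edgeDir p q s c a b) → Edge a b
    edgeDir⇒Edge a b t with T∨ t
    ... | inj₁ t₁ = let (x , y) = T∧ t₁ in p-path (ℕ.≡ᵇ⇒≡ _ _ x) (ℕ.<ᵇ⇒< _ _ y)
    ... | inj₂ t with T∨ t
    ... | inj₁ t₂ = let (x , y) = T∧ t₂ in p-close (ℕ.≡ᵇ⇒≡ _ _ x) (ℕ.≡ᵇ⇒≡ _ _ y)
    ... | inj₂ t with T∨ t
    ... | inj₁ t₃ = let (x , y) = T∧ t₃ in q-open (ℕ.≡ᵇ⇒≡ _ _ x) (ℕ.≡ᵇ⇒≡ _ _ y)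
    ... | inj₂ t with T∨ t
    ... | inj₁ t₄ = let (x , yz) = T∧ t₄ ; (y , z) = T∧ yz in q-path (ℕ.≤ᵇ⇒≤ _ _ x) (ℕ.≡ᵇ⇒≡ _ _ y) (ℕ.≤ᵇ⇒≤ _ _ z)
    ... | inj₂ t with T∨ t
    ... | inj₁ t₅ = let (x , y) = T∧ t₅ in q-close (ℕ.≡ᵇ⇒≡ _ _ x) (ℕ.≡ᵇ⇒≡ _ _ y)
    ... | inj₂ t₆ = let (x , yz) = T∧ t₆ ; (y , z) = T∧ yz in pendant (ℕ.≡ᵇ⇒≡ _ _ x) (ℕ.≤ᵇ⇒≤ _ _ y) (ℕ.<ᵇ⇒< _ _ z)

    d₁ d₂ d₃ d₄ d₅ : ℕ → ℕ → Bool
    d₁ a b = (b ≡ᵇ suc a) ∧ (b <ᵇ p)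
    d₂ a b = (a ≡ᵇ 0) ∧ (b ≡ᵇ p ∸ 1)
    d₃ a b = (a ≡ᵇ 0) ∧ (b ≡ᵇ p)
    d₄ a b = (p ≤ᵇ a) ∧ (b ≡ᵇ suc a) ∧ (b ≤ᵇ p ℕ.+ q ∸ 2)
    d₅ a b = (a ≡ᵇ 0) ∧ (b ≡ᵇ p ℕ.+ q ∸ 2)

    Edge⇒edgeDir : ∀ {a b} → Edge a b → T (edgeDir p q s c a b)
    Edge⇒edgeDir {a} {b} (p-path x y) =
      T∨ˡ _ (T∧-intro (ℕ.≡⇒≡ᵇ _ _ x) (ℕ.<⇒<ᵇ y))
    Edge⇒edgeDir {a} {b} (p-close x y) =
      T∨ʳ (d₁ a b) (T∨ˡ _ (T∧-intro (ℕ.≡⇒≡ᵇ _ _ x) (ℕ.≡⇒≡ᵇ _ _ y)))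
    Edge⇒edgeDir {a} {b} (q-open x y) =
      T∨ʳ (d₁ a b) (T∨ʳ (d₂ a b) (T∨ˡ _ (T∧-intro (ℕ.≡⇒≡ᵇ _ _ x) (ℕ.≡⇒≡ᵇ _ _ y))))
    Edge⇒edgeDir {a} {b} (q-path x y z) =
      T∨ʳ (d₁ a b) (T∨ʳ (d₂ a b) (T∨ʳ (d₃ a b) (T∨ˡ _
        (T∧-intro (ℕ.≤⇒≤ᵇ x) (T∧-intro (ℕ.≡⇒≡ᵇ _ _ y) (ℕ.≤⇒≤ᵇ z))))))
    Edge⇒edgeDir {a} {b} (q-close x y) =
      T∨ʳ (d₁ a b) (T∨ʳ (d₂ a b) (T∨ʳ (d₃ a b) (T∨ʳ (d₄ a b) (T∨ˡ _ (T∧-intro (ℕ.≡⇒≡ᵇ _ _ x) (ℕ.≡⇒≡ᵇ _ _ y))))))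
    Edge⇒edgeDir {a} {b} (pendant x y z) =
      T∨ʳ (d₁ a b) (T∨ʳ (d₂ a b) (T∨ʳ (d₃ a b) (T∨ʳ (d₄ a b) (T∨ʳ (d₅ a b)
        (T∧-intro (ℕ.≡⇒≡ᵇ _ _ x) (T∧-intro (ℕ.≤⇒≤ᵇ y) (ℕ.<⇒<ᵇ z)))))))

  adj⇒Adjacent : ∀ a b → T (adj Gr a b) → Adjacent a b
  adj⇒Adjacent a b t with T∨ t
  ... | inj₁ t = inj₁ (edgeDir⇒Edge a b t)
  ... | inj₂ t = inj₂ (edgeDir⇒Edge b a t)

  Adjacent⇒adj : ∀ {a b} → Adjacent a b → T (adj Gr a b)
  Adjacent⇒adj {a} {b} (inj₁ e) = T∨ˡ _ (Edge⇒edgeDir e)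
  Adjacent⇒adj {a} {b} (inj₂ e) = T∨ʳ (edgeDir p q s c a b) (Edge⇒edgeDir e)

  p<M : p < M
  p<M = subst (p <_) (sym M≡p+1+q') (ℕ.m<m+n p (s≤s z≤n))
    where
    M≡p+1+q' : M ≡ p ℕ.+ suc q'
    M≡p+1+q' = cong suc (trans (ℕ.+-suc p' (suc (suc q'))) (cong suc (ℕ.+-suc p' (suc q'))))

  M<N : M < N
  M<N = ℕ.n<1+n M

  p<N : p < N
  p<N = ℕ.<-trans p<M M<N

  p∸1<N : p ∸ 1 < N
  p∸1<N = ℕ.<-trans (ℕ.n<1+n (p ∸ 1)) p<N

  p≤M∸1 : p ≤ M ∸ 1
  p≤M∸1 = ℕ.≤-pred p<M

  coreΣ : ℕ → (ℕ → ℚ) → ℚ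
  coreΣ v f = Σ[< N ] (λ y → ind (adj Gr v y) (f y))

  private
    coreΣ-pair : ∀ v a b (f : ℕ → ℚ) → a < N → b < N → a ≢ b → Adjacent v a → Adjacent v b →
                 (∀ y → y < N → Adjacent v y → y ∈ a ∷ b ∷ []) → coreΣ v f ≡ f a + f b
    coreΣ-pair v a b f a<N b<N a≢b v~a v~b nbrs =
      trans (Σ-support N (adj Gr v) f (a ∷ b ∷ []) ((a≢b ∷ []) ∷ [] ∷ []) (a<N ∷ b<N ∷ [])
                       (Adjacent⇒adj v~a ∷ Adjacent⇒adj v~b ∷ []) (λ y y<N t → nbrs y y<N (adj⇒Adjacent v y t)))
            (cong (f a +_) (+-identityʳ (f b)))

  w-neighbours : ∀ y → y < N → Adjacent 0 y → y ∈ 1 ∷ p ∸ 1 ∷ p ∷ M ∷ []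
  w-neighbours y y<N (inj₁ (p-path x _))    = here x
  w-neighbours y y<N (inj₁ (p-close _ x))   = there (here x)
  w-neighbours y y<N (inj₁ (q-open _ x))    = there (there (here x))
  w-neighbours y y<N (inj₁ (q-path () _ _))
  w-neighbours y y<N (inj₁ (q-close _ x))   = there (there (there (here x)))
  w-neighbours y y<N (inj₁ (pendant _ N≤y _)) = ⊥-elim (ℕ.<⇒≱ y<N N≤y)
  w-neighbours y y<N (inj₂ (p-path () _))
  w-neighbours y y<N (inj₂ (p-close _ ()))
  w-neighbours y y<N (inj₂ (q-open _ ()))
  w-neighbours y y<N (inj₂ (q-path _ () _))
  w-neighbours y y<N (inj₂ (q-close _ ()))
  w-neighbours y y<N (inj₂ (pendant _ () _))

  coreΣ-w : ∀ f → coreΣ 0 f ≡ f 1 + f (p ∸ 1) + f p + f M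
  coreΣ-w f = trans
    (Σ-support N (adj Gr 0) f (1 ∷ p ∸ 1 ∷ p ∷ M ∷ [])
      (((λ ()) ∷ (λ ()) ∷ ℕ.<⇒≢ (ℕ.<-trans (s≤s (s≤s z≤n)) p<M) ∷ [])
        ∷ (ℕ.<⇒≢ (ℕ.n<1+n (p ∸ 1)) ∷ ℕ.<⇒≢ (ℕ.<-trans (ℕ.n<1+n (p ∸ 1)) p<M) ∷ [])
        ∷ (ℕ.<⇒≢ p<M ∷ []) ∷ [] ∷ [])
      (ℕ.<-trans (s≤s (s≤s z≤n)) p<N ∷ p∸1<N ∷ p<N ∷ M<N ∷ [])
      (Adjacent⇒adj (inj₁ (p-path refl (s≤s (s≤s z≤n)))) ∷ Adjacent⇒adj (inj₁ (p-close refl refl))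
        ∷ Adjacent⇒adj (inj₁ (q-open refl refl)) ∷ Adjacent⇒adj (inj₁ (q-close refl refl)) ∷ [])
      (λ y y<N t → w-neighbours y y<N (adj⇒Adjacent 0 y t)))
    (solve 4 (λ a b c d → a :+ (b :+ (c :+ (d :+ con 0ℚ))) := a :+ b :+ c :+ d) refl (f 1) (f (p ∸ 1)) (f p) (f M))

  p-inner-neighbours : ∀ t y → suc (suc t) < p → y < N → Adjacent (suc t) y → y ∈ t ∷ suc (suc t) ∷ []
  p-inner-neighbours t y lt y<N (inj₁ (p-path x _)) = there (here x)
  p-inner-neighbours t y lt y<N (inj₁ (p-close () _))
  p-inner-neighbours t y lt y<N (inj₁ (q-open () _))
  p-inner-neighbours t y lt y<N (inj₁ (q-path p≤ _ _)) = ⊥-elim (ℕ.<⇒≱ (ℕ.<-trans (ℕ.n<1+n (suc t)) lt) p≤)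
  p-inner-neighbours t y lt y<N (inj₁ (q-close () _))
  p-inner-neighbours t y lt y<N (inj₁ (pendant _ N≤y _)) = ⊥-elim (ℕ.<⇒≱ y<N N≤y)
  p-inner-neighbours t y lt y<N (inj₂ (p-path x _)) = here (sym (ℕ.suc-injective x))
  p-inner-neighbours t y lt y<N (inj₂ (p-close _ x)) = ⊥-elim (ℕ.<-irrefl (cong suc x) lt)
  p-inner-neighbours t y lt y<N (inj₂ (q-open _ x)) = ⊥-elim (ℕ.<-irrefl x (ℕ.<-trans (ℕ.n<1+n (suc t)) lt))
  p-inner-neighbours t y lt y<N (inj₂ (q-path p≤y x _)) =
    ⊥-elim (ℕ.<⇒≱ (subst (λ z → suc z < p) (ℕ.suc-injective x) (ℕ.<-trans (ℕ.n<1+n (suc t)) lt)) (ℕ.≤-trans p≤y (ℕ.n≤1+n y)))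
  p-inner-neighbours t y lt y<N (inj₂ (q-close _ x)) = ⊥-elim (ℕ.<-irrefl x (ℕ.<-trans (ℕ.<-trans (ℕ.n<1+n (suc t)) lt) p<M))
  p-inner-neighbours t y lt y<N (inj₂ (pendant _ N≤ _)) = ⊥-elim (ℕ.<⇒≱ (ℕ.<-trans (ℕ.<-trans (ℕ.n<1+n (suc t)) lt) p<N) N≤)

  coreΣ-p-inner : ∀ t f → suc (suc t) < p → coreΣ (suc t) f ≡ f t + f (suc (suc t))
  coreΣ-p-inner t f lt = coreΣ-pair (suc t) t (suc (suc t)) f
    (ℕ.<-trans (ℕ.<-trans (ℕ.<-trans (ℕ.n<1+n t) (ℕ.n<1+n (suc t))) lt) p<N) (ℕ.<-trans lt p<N)
    (ℕ.<⇒≢ (ℕ.<-trans (ℕ.n<1+n t) (ℕ.n<1+n (suc t))))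
    (inj₂ (p-path refl (ℕ.<-trans (ℕ.n<1+n (suc t)) lt))) (inj₁ (p-path refl lt))
    (λ y → p-inner-neighbours t y lt)

  p-last-neighbours : ∀ y → y < N → Adjacent (p ∸ 1) y → y ∈ p ∸ 2 ∷ 0 ∷ []
  p-last-neighbours y y<N (inj₁ (p-path x lt)) = ⊥-elim (ℕ.<-irrefl x lt)
  p-last-neighbours y y<N (inj₁ (p-close () _))
  p-last-neighbours y y<N (inj₁ (q-open () _))
  p-last-neighbours y y<N (inj₁ (q-path p≤ _ _)) = ⊥-elim (ℕ.<⇒≱ (ℕ.n<1+n (p ∸ 1)) p≤)
  p-last-neighbours y y<N (inj₁ (q-close () _))
  p-last-neighbours y y<N (inj₁ (pendant _ N≤y _)) = ⊥-elim (ℕ.<⇒≱ y<N N≤y)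
  p-last-neighbours y y<N (inj₂ (p-path x _)) = here (sym (ℕ.suc-injective x))
  p-last-neighbours y y<N (inj₂ (p-close x _)) = there (here x)
  p-last-neighbours y y<N (inj₂ (q-open _ x)) = ⊥-elim (ℕ.<-irrefl x (ℕ.n<1+n (p ∸ 1)))
  p-last-neighbours y y<N (inj₂ (q-path p≤y x _)) =
    ⊥-elim (ℕ.<⇒≱ (subst (λ z → suc z < p) (ℕ.suc-injective x) (ℕ.n<1+n (p ∸ 1))) (ℕ.≤-trans p≤y (ℕ.n≤1+n y)))
  p-last-neighbours y y<N (inj₂ (q-close _ x)) = ⊥-elim (ℕ.<-irrefl x (ℕ.<-trans (ℕ.n<1+n (p ∸ 1)) p<M))
  p-last-neighbours y y<N (inj₂ (pendant _ N≤ _)) = ⊥-elim (ℕ.<⇒≱ p∸1<N N≤)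

  coreΣ-p-last : ∀ f → coreΣ (p ∸ 1) f ≡ f (p ∸ 2) + f 0
  coreΣ-p-last f = coreΣ-pair (p ∸ 1) (p ∸ 2) 0 f
    (ℕ.<-trans (ℕ.n<1+n (p ∸ 2)) p∸1<N) (s≤s z≤n) (λ ())
    (inj₂ (p-path refl (ℕ.n<1+n (p ∸ 1)))) (inj₂ (p-close refl refl))
    p-last-neighbours

  q-first-neighbours : ∀ y → y < N → Adjacent p y → y ∈ 0 ∷ suc p ∷ []
  q-first-neighbours y y<N (inj₁ (p-path x lt)) = ⊥-elim (ℕ.<⇒≱ lt (subst (p ≤_) (sym x) (ℕ.n≤1+n p)))
  q-first-neighbours y y<N (inj₁ (p-close () _))
  q-first-neighbours y y<N (inj₁ (q-open () _))
  q-first-neighbours y y<N (inj₁ (q-path _ x _)) = there (here x)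
  q-first-neighbours y y<N (inj₁ (q-close () _))
  q-first-neighbours y y<N (inj₁ (pendant _ N≤y _)) = ⊥-elim (ℕ.<⇒≱ y<N N≤y)
  q-first-neighbours y y<N (inj₂ (p-path x lt)) = ⊥-elim (ℕ.<-irrefl refl lt)
  q-first-neighbours y y<N (inj₂ (p-close x _)) = here x
  q-first-neighbours y y<N (inj₂ (q-open x _)) = here x
  q-first-neighbours y y<N (inj₂ (q-path p≤y x _)) = ⊥-elim (ℕ.<⇒≱ (subst (y <_) (sym x) (ℕ.n<1+n y)) p≤y)
  q-first-neighbours y y<N (inj₂ (q-close x _)) = here x
  q-first-neighbours y y<N (inj₂ (pendant _ N≤ _)) = ⊥-elim (ℕ.<⇒≱ p<N N≤)

  coreΣ-q-first : ∀ f → coreΣ p f ≡ f 0 + f (suc p)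
  coreΣ-q-first f = coreΣ-pair p 0 (suc p) f (s≤s z≤n) (s≤s p<M) (λ ())
    (inj₂ (q-open refl refl)) (inj₁ (q-path ℕ.≤-refl refl p<M))
    q-first-neighbours

  q-inner-neighbours : ∀ t y → p ≤ t → suc t < M → y < N → Adjacent (suc t) y → y ∈ t ∷ suc (suc t) ∷ []
  q-inner-neighbours t y p≤ lt y<N (inj₁ (p-path x lt′)) =
    ⊥-elim (ℕ.<⇒≱ lt′ (subst (p ≤_) (sym x) (ℕ.≤-trans p≤ (ℕ.≤-trans (ℕ.n≤1+n t) (ℕ.n≤1+n (suc t))))))
  q-inner-neighbours t y p≤ lt y<N (inj₁ (p-close () _))
  q-inner-neighbours t y p≤ lt y<N (inj₁ (q-open () _))
  q-inner-neighbours t y p≤ lt y<N (inj₁ (q-path _ x _)) = there (here x)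
  q-inner-neighbours t y p≤ lt y<N (inj₁ (q-close () _))
  q-inner-neighbours t y p≤ lt y<N (inj₁ (pendant _ N≤y _)) = ⊥-elim (ℕ.<⇒≱ y<N N≤y)
  q-inner-neighbours t y p≤ lt y<N (inj₂ (p-path x lt′)) = ⊥-elim (ℕ.<⇒≱ lt′ (ℕ.≤-trans p≤ (ℕ.n≤1+n t)))
  q-inner-neighbours t y p≤ lt y<N (inj₂ (p-close _ x)) =
    ⊥-elim (ℕ.<⇒≱ (subst (_< p) (sym x) (ℕ.n<1+n (p ∸ 1))) (ℕ.≤-trans p≤ (ℕ.n≤1+n t)))
  q-inner-neighbours t y p≤ lt y<N (inj₂ (q-open _ x)) = ⊥-elim (ℕ.<⇒≱ (subst (p <_) x (s≤s p≤)) ℕ.≤-refl)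
  q-inner-neighbours t y p≤ lt y<N (inj₂ (q-path _ x _)) = here (sym (ℕ.suc-injective x))
  q-inner-neighbours t y p≤ lt y<N (inj₂ (q-close _ x)) = ⊥-elim (ℕ.<-irrefl x lt)
  q-inner-neighbours t y p≤ lt y<N (inj₂ (pendant _ N≤ _)) = ⊥-elim (ℕ.<⇒≱ (ℕ.<-trans lt M<N) N≤)

  coreΣ-q-inner : ∀ t f → p ≤ t → suc t < M → coreΣ (suc t) f ≡ f t + f (suc (suc t))
  coreΣ-q-inner t f p≤ lt = coreΣ-pair (suc t) t (suc (suc t)) f
    (ℕ.<-trans (ℕ.<-trans (ℕ.n<1+n t) lt) M<N) (s≤s lt) (ℕ.<⇒≢ (ℕ.<-trans (ℕ.n<1+n t) (ℕ.n<1+n (suc t))))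
    (inj₂ (q-path p≤ refl (ℕ.<⇒≤ lt))) (inj₁ (q-path (ℕ.≤-trans p≤ (ℕ.n≤1+n t)) refl lt))
    (λ y → q-inner-neighbours t y p≤ lt)

  q-last-neighbours : ∀ y → y < N → Adjacent M y → y ∈ M ∸ 1 ∷ 0 ∷ []
  q-last-neighbours y y<N (inj₁ (p-path x lt)) = ⊥-elim (ℕ.<⇒≱ lt (subst (p ≤_) (sym x) (ℕ.≤-trans (ℕ.<⇒≤ p<M) (ℕ.n≤1+n M))))
  q-last-neighbours y y<N (inj₁ (p-close () _))
  q-last-neighbours y y<N (inj₁ (q-open () _))
  q-last-neighbours y y<N (inj₁ (q-path _ x le)) = ⊥-elim (ℕ.<⇒≱ (ℕ.n<1+n M) (subst (_≤ M) x le))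
  q-last-neighbours y y<N (inj₁ (q-close () _))
  q-last-neighbours y y<N (inj₁ (pendant _ N≤y _)) = ⊥-elim (ℕ.<⇒≱ y<N N≤y)
  q-last-neighbours y y<N (inj₂ (p-path x lt)) = ⊥-elim (ℕ.<⇒≱ lt (ℕ.<⇒≤ p<M))
  q-last-neighbours y y<N (inj₂ (p-close _ x)) = ⊥-elim (ℕ.<-irrefl (sym x) (ℕ.<-trans (ℕ.n<1+n (p ∸ 1)) p<M))
  q-last-neighbours y y<N (inj₂ (q-open _ x)) = ⊥-elim (ℕ.<-irrefl (sym x) p<M)
  q-last-neighbours y y<N (inj₂ (q-path _ x _)) = here (sym (ℕ.suc-injective x))
  q-last-neighbours y y<N (inj₂ (q-close x _)) = there (here x)
  q-last-neighbours y y<N (inj₂ (pendant _ N≤ _)) = ⊥-elim (ℕ.<⇒≱ M<N N≤)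

  coreΣ-q-last : ∀ f → coreΣ M f ≡ f (M ∸ 1) + f 0
  coreΣ-q-last f = coreΣ-pair M (M ∸ 1) 0 f (ℕ.<-trans (ℕ.n<1+n (M ∸ 1)) M<N) (s≤s z≤n)
    (λ e → ℕ.<-irrefl (sym e) (ℕ.<-trans (s≤s z≤n) p≤M∸1))
    (inj₂ (q-path p≤M∸1 refl ℕ.≤-refl)) (inj₂ (q-close refl refl))
    q-last-neighbours

  data CoreVertex (v : ℕ) : Set where
    at-w       : v ≡ 0 → CoreVertex v
    at-p-inner : ∀ t → v ≡ suc t → suc (suc t) < p → CoreVertex v
    at-p-last  : v ≡ p ∸ 1 → CoreVertex v
    at-q-first : v ≡ p → CoreVertex v
    at-q-inner : ∀ t → v ≡ suc t → p ≤ t → suc t < M → CoreVertex v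
    at-q-last  : v ≡ M → CoreVertex v

  coreVertex : ∀ v → v < N → CoreVertex v
  coreVertex zero _ = at-w refl
  coreVertex (suc t) v<N with ℕ.<-cmp (suc t) (p ∸ 1)
  ... | tri< lt _ _ = at-p-inner t refl (s≤s lt)
  ... | tri≈ _ eq _ = at-p-last eq
  ... | tri> _ _ gt with ℕ.<-cmp (suc t) p
  ...   | tri< lt _ _ = ⊥-elim (ℕ.<⇒≱ lt gt)
  ...   | tri≈ _ eq _ = at-q-first eq
  ...   | tri> _ _ gt′ with ℕ.<-cmp (suc t) M
  ...     | tri< lt _ _ = at-q-inner t refl (ℕ.≤-pred gt′) lt
  ...     | tri≈ _ eq _ = at-q-last eq
  ...     | tri> _ _ gt″ = ⊥-elim (ℕ.<⇒≱ v<N gt″)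

  coreDegree : ℕ → ℕ
  coreDegree x = if x ≡ᵇ 0 then 4 else 2

  coreΣ-1 : ∀ x → x < N → coreΣ x (λ _ → 1ℚ) ≡ ℕtoℚ (coreDegree x)
  coreΣ-1 x x<N with coreVertex x x<N
  ... | at-w refl              = coreΣ-w (λ _ → 1ℚ)
  ... | at-p-inner t refl lt   = coreΣ-p-inner t (λ _ → 1ℚ) lt
  ... | at-p-last refl         = coreΣ-p-last (λ _ → 1ℚ)
  ... | at-q-first refl        = coreΣ-q-first (λ _ → 1ℚ)
  ... | at-q-inner t refl p≤ lt = coreΣ-q-inner t (λ _ → 1ℚ) p≤ lt
  ... | at-q-last refl         = coreΣ-q-last (λ _ → 1ℚ)

  N≤n : N ≤ n
  N≤n = ℕ.m≤m+n N s

  pendant<n : ∀ {i} → i < s → N ℕ.+ i < n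
  pendant<n i<s = ℕ.+-monoʳ-< N i<s

  module _ (c<N : c < N) where

    pendant-attached-at-c : ∀ a b → N ≤ b → Adjacent a b → a ≡ c
    pendant-attached-at-c a b N≤b (inj₁ (p-path x lt)) = ⊥-elim (ℕ.<⇒≱ (ℕ.<-trans lt p<N) N≤b)
    pendant-attached-at-c a b N≤b (inj₁ (p-close _ x)) = ⊥-elim (ℕ.<⇒≱ (subst (_< N) (sym x) p∸1<N) N≤b)
    pendant-attached-at-c a b N≤b (inj₁ (q-open _ x)) = ⊥-elim (ℕ.<⇒≱ (subst (_< N) (sym x) p<N) N≤b)
    pendant-attached-at-c a b N≤b (inj₁ (q-path _ _ le)) = ⊥-elim (ℕ.<⇒≱ (s≤s le) N≤b)
    pendant-attached-at-c a b N≤b (inj₁ (q-close _ x)) = ⊥-elim (ℕ.<⇒≱ (subst (_< N) (sym x) M<N) N≤b)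
    pendant-attached-at-c a b N≤b (inj₁ (pendant x _ _)) = x
    pendant-attached-at-c a b N≤b (inj₂ (p-path x lt)) =
      ⊥-elim (ℕ.<⇒≱ (ℕ.<-trans (subst (b <_) (sym x) (ℕ.n<1+n b)) (ℕ.<-trans lt p<N)) N≤b)
    pendant-attached-at-c a b N≤b (inj₂ (p-close x _)) = ⊥-elim (ℕ.<⇒≱ (subst (_< N) (sym x) (s≤s z≤n)) N≤b)
    pendant-attached-at-c a b N≤b (inj₂ (q-open x _)) = ⊥-elim (ℕ.<⇒≱ (subst (_< N) (sym x) (s≤s z≤n)) N≤b)
    pendant-attached-at-c a b N≤b (inj₂ (q-path _ x le)) = ⊥-elim (ℕ.<⇒≱ (ℕ.<-trans (subst (_≤ M) x le) M<N) N≤b)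
    pendant-attached-at-c a b N≤b (inj₂ (q-close x _)) = ⊥-elim (ℕ.<⇒≱ (subst (_< N) (sym x) (s≤s z≤n)) N≤b)
    pendant-attached-at-c a b N≤b (inj₂ (pendant x _ _)) = ⊥-elim (ℕ.<⇒≱ (subst (_< N) (sym x) c<N) N≤b)

    adj-pendant : ∀ v i → i < s → adj Gr v (N ℕ.+ i) ≡ (v ≡ᵇ c)
    adj-pendant v i i<s with v ℕ.≟ c
    ... | yes refl = trans (T⇒≡true (Adjacent⇒adj (inj₁ (pendant refl (ℕ.m≤m+n N i) (pendant<n i<s)))))
                           (sym (≡ᵇ-refl v))
    ... | no v≢c = trans (¬T⇒≡false (λ t → v≢c (pendant-attached-at-c v (N ℕ.+ i) (ℕ.m≤m+n N i) (adj⇒Adjacent v (N ℕ.+ i) t))))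
                         (sym (≢⇒≡ᵇ-false v≢c))

    Σ-neighbours-core : ∀ v (f : ℕ → ℚ) → Σ[< n ] (λ y → ind (adj Gr v y) (f y))
                        ≡ coreΣ v f + ind (v ≡ᵇ c) (Σ[< s ] (λ i → f (N ℕ.+ i)))
    Σ-neighbours-core v f = trans (Σ-split N s (λ y → ind (adj Gr v y) (f y)))
      (cong (coreΣ v f +_)
        (trans (Σ-cong s (λ i i<s → cong (λ b → ind b (f (N ℕ.+ i))) (adj-pendant v i i<s)))
               (Σ-ind s (v ≡ᵇ c) (λ i → f (N ℕ.+ i)))))

    Σ-neighbours-pendant : ∀ v (f : ℕ → ℚ) → N ≤ v → v < n → Σ[< n ] (λ y → ind (adj Gr v y) (f y)) ≡ f c
    Σ-neighbours-pendant v f N≤v v<n =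
      trans (Σ-single n c (λ y → ind (adj Gr v y) (f y)) (ℕ.<-≤-trans c<N N≤n)
              (λ y _ y≢c → cong (λ b → ind b (f y))
                 (¬T⇒≡false (λ t → y≢c (pendant-attached-at-c y v N≤v (Adjacent-sym (adj⇒Adjacent v y t)))))))
            (cong (λ b → ind b (f c)) (T⇒≡true (Adjacent⇒adj (inj₂ (pendant refl N≤v v<n)))))

    degree-core : ∀ x → x < N → ℕtoℚ (deg Gr x) ≡ ℕtoℚ (coreDegree x) + ind (x ≡ᵇ c) (ℕtoℚ s)
    degree-core x x<N = trans (Σ-count n (adj Gr x)) (trans (Σ-neighbours-core x (λ _ → 1ℚ))
      (cong₂ _+_ (coreΣ-1 x x<N) (cong (ind (x ≡ᵇ c)) (trans (Σ-const s 1ℚ) (*-identityʳ (ℕtoℚ s))))))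

    degree-pendant : ∀ x → N ≤ x → x < n → ℕtoℚ (deg Gr x) ≡ 1ℚ
    degree-pendant x N≤x x<n = trans (Σ-count n (adj Gr x)) (Σ-neighbours-pendant x (λ _ → 1ℚ) N≤x x<n)

    connected : Connected Gr
    connected S closed a b a<n b<n Sa = proj₂ (linked b b<n) (proj₁ (linked a a<n) Sa)
      where
      Linked : ℕ → ℕ → Set
      Linked x y = (S x → S y) × (S y → S x)
      _⨾_ : ∀ {x y z} → Linked x y → Linked y z → Linked x z
      (f , g) ⨾ (h , k) = (h ∘ f) , (g ∘ k)
      along : ∀ {x y} → x < n → y < n → Adjacent x y → Linked x y
      along x<n y<n x~y = closed _ _ x<n y<n (Adjacent⇒adj x~y) , closed _ _ y<n x<n (Adjacent⇒adj (Adjacent-sym x~y))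
      core<n : ∀ {z} → z < N → z < n
      core<n z<N = ℕ.<-≤-trans z<N N≤n
      core-linked : ∀ z → z < N → Linked z 0
      core-linked zero _ = id , id
      core-linked (suc z) z+1<N with ℕ.<-cmp (suc z) p
      ... | tri< lt _ _ = along (core<n z+1<N) (core<n z<N) (inj₂ (p-path refl lt)) ⨾ core-linked z z<N
        where z<N = ℕ.<-trans (ℕ.n<1+n z) z+1<N
      ... | tri≈ _ refl _ = along (core<n p<N) (core<n (s≤s z≤n)) (inj₂ (q-open refl refl))
      ... | tri> _ _ gt = along (core<n z+1<N) (core<n z<N) (inj₂ (q-path (ℕ.≤-pred gt) refl (ℕ.≤-pred z+1<N)))
                          ⨾ core-linked z z<N
        where z<N = ℕ.<-trans (ℕ.n<1+n z) z+1<N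
      linked : ∀ z → z < n → Linked z 0
      linked z z<n with z ℕ.<? N
      ... | yes z<N = core-linked z z<N
      ... | no z≮N = along z<n (core<n c<N) (inj₂ (pendant refl (ℕ.≮⇒≥ z≮N) z<n)) ⨾ core-linked c c<N

module CoreGreen (p' q' s c : ℕ) where

  open import Data.Bool using (true; false; _∧_; if_then_else_)
  open import Data.Nat as ℕ using (suc; _∸_; _≤_; _<_; z≤n; s≤s; _≡ᵇ_; _<ᵇ_; _≤ᵇ_)
  import Data.Nat.Properties as ℕ
  open import Data.Rational using (ℚ; 0ℚ; 1ℚ; _*_; 1/_)
  open import Data.Rational.Properties using (*-inverseʳ)
  open import Data.Product using (_×_; _,_)
  open import Relation.Nullary using (Dec; yes; no)
  open import Relation.Binary.PropositionalEquality
  open import Defs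
  open NatCast
  open FiniteSums
  open CycleGreen
  open BicyclicGraph p' q' s c public

  inv-suc : ℕ → ℚ
  inv-suc k = (1/ ℕtoℚ (suc k)) {{ℕtoℚ-suc-nonZero k}}

  *-inv-suc : ∀ k → ℕtoℚ (suc k) * inv-suc k ≡ 1ℚ
  *-inv-suc k = *-inverseʳ (ℕtoℚ (suc k)) {{ℕtoℚ-suc-nonZero k}}

  p⁻¹ q⁻¹ : ℚ
  p⁻¹ = inv-suc (suc (suc p'))
  q⁻¹ = inv-suc (suc (suc q'))

  -- Position on C_q, counted from w: the C_q-vertices p, p+1, …, M are at positions 1, 2, …, q-1.
  qPos : ℕ → ℕ
  qPos y = y ∸ (p ∸ 1)

  -- The potential of a unit current from a to w in the core: since w is a cut vertex,
  -- it is the cycle potential on the block containing a and zero on the other block.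
  coreGreen : ℕ → ℕ → ℚ
  coreGreen a b = if (a <ᵇ p) ∧ (b <ᵇ p) then cycleGreen p⁻¹ a b
                  else if (p ≤ᵇ a) ∧ (p ≤ᵇ b) then cycleGreen q⁻¹ (qPos a) (qPos b) else 0ℚ

  private
    <ᵇ-true : ∀ {a} → a < p → (a <ᵇ p) ≡ true
    <ᵇ-true a<p = T⇒≡true (ℕ.<⇒<ᵇ a<p)
    <ᵇ-false : ∀ {a} → p ≤ a → (a <ᵇ p) ≡ false
    <ᵇ-false p≤a = ¬T⇒≡false (λ t → ℕ.<⇒≱ (ℕ.<ᵇ⇒< _ _ t) p≤a)
    ≤ᵇ-true : ∀ {a} → p ≤ a → (p ≤ᵇ a) ≡ true
    ≤ᵇ-true p≤a = T⇒≡true (ℕ.≤⇒≤ᵇ p≤a)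
    ≤ᵇ-false : ∀ {a} → a < p → (p ≤ᵇ a) ≡ false
    ≤ᵇ-false a<p = ¬T⇒≡false (λ t → ℕ.<⇒≱ a<p (ℕ.≤ᵇ⇒≤ _ _ t))

  coreGreen-pp : ∀ {a b} → a < p → b < p → coreGreen a b ≡ cycleGreen p⁻¹ a b
  coreGreen-pp a<p b<p rewrite <ᵇ-true a<p | <ᵇ-true b<p = refl

  coreGreen-qq : ∀ {a b} → p ≤ a → p ≤ b → coreGreen a b ≡ cycleGreen q⁻¹ (qPos a) (qPos b)
  coreGreen-qq p≤a p≤b rewrite <ᵇ-false p≤a | ≤ᵇ-true p≤a | ≤ᵇ-true p≤b = refl

  coreGreen-pq : ∀ {a b} → a < p → p ≤ b → coreGreen a b ≡ 0ℚ
  coreGreen-pq a<p p≤b rewrite <ᵇ-true a<p | <ᵇ-false p≤b | ≤ᵇ-false a<p = refl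

  coreGreen-qp : ∀ {a b} → p ≤ a → b < p → coreGreen a b ≡ 0ℚ
  coreGreen-qp p≤a b<p rewrite <ᵇ-false p≤a | ≤ᵇ-true p≤a | ≤ᵇ-false b<p = refl

  coreGreen-wˡ : ∀ b → coreGreen 0 b ≡ 0ℚ
  coreGreen-wˡ b = by-block (b ℕ.<? p)
    where
    by-block : Dec (b < p) → coreGreen 0 b ≡ 0ℚ
    by-block (yes b<p) = trans (coreGreen-pp (s≤s z≤n) b<p) (cycleGreen-0ˡ p⁻¹ b)
    by-block (no b≮p)  = coreGreen-pq (s≤s z≤n) (ℕ.≮⇒≥ b≮p)

  coreGreen-sym : ∀ a b → coreGreen a b ≡ coreGreen b a
  coreGreen-sym a b = by-blocks (a ℕ.<? p) (b ℕ.<? p)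
    where
    by-blocks : Dec (a < p) → Dec (b < p) → coreGreen a b ≡ coreGreen b a
    by-blocks (yes a<p) (yes b<p) =
      trans (coreGreen-pp a<p b<p) (trans (cycleGreen-sym p⁻¹ a b) (sym (coreGreen-pp b<p a<p)))
    by-blocks (yes a<p) (no b≮p) = trans (coreGreen-pq a<p (ℕ.≮⇒≥ b≮p)) (sym (coreGreen-qp (ℕ.≮⇒≥ b≮p) a<p))
    by-blocks (no a≮p) (yes b<p) = trans (coreGreen-qp (ℕ.≮⇒≥ a≮p) b<p) (sym (coreGreen-pq b<p (ℕ.≮⇒≥ a≮p)))
    by-blocks (no a≮p) (no b≮p) =
      trans (coreGreen-qq (ℕ.≮⇒≥ a≮p) (ℕ.≮⇒≥ b≮p))
            (trans (cycleGreen-sym q⁻¹ (qPos a) (qPos b)) (sym (coreGreen-qq (ℕ.≮⇒≥ b≮p) (ℕ.≮⇒≥ a≮p))))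

  coreGreen-wʳ : ∀ a → coreGreen a 0 ≡ 0ℚ
  coreGreen-wʳ a = trans (coreGreen-sym a 0) (coreGreen-wˡ a)

  qPos-suc : ∀ {x} → p ∸ 1 ≤ x → qPos (suc x) ≡ suc (qPos x)
  qPos-suc p∸1≤x = ℕ.+-∸-assoc 1 p∸1≤x

  qPos-p : qPos p ≡ 1
  qPos-p = ℕ.m+n∸n≡m 1 p'

  qPos-M : qPos M ≡ q ∸ 1
  qPos-M = trans (cong (_∸ suc p') (ℕ.+-suc p' (suc (suc q')))) (ℕ.m+n∸m≡n (suc p') (suc (suc q')))

  qPos-M∸1 : qPos (M ∸ 1) ≡ q ∸ 2
  qPos-M∸1 = trans (cong (_∸ suc (suc p')) (trans (ℕ.+-suc p' (suc (suc q'))) (cong suc (ℕ.+-suc p' (suc q')))))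
                   (ℕ.m+n∸m≡n (suc (suc p')) (suc q'))

  qPos-≡ᵇ : ∀ {x y} → p ∸ 1 ≤ x → p ∸ 1 ≤ y → (x ≡ᵇ y) ≡ (qPos x ≡ᵇ qPos y)
  qPos-≡ᵇ {x} {y} hx hy with x ℕ.≟ y
  ... | yes refl = trans (≡ᵇ-refl x) (sym (≡ᵇ-refl (qPos x)))
  ... | no x≢y   = trans (≢⇒≡ᵇ-false x≢y) (sym (≢⇒≡ᵇ-false (λ e → x≢y (ℕ.∸-cancelʳ-≡ hx hy e))))

  qPos-range : ∀ {a} → p ≤ a → a < N → 1 ≤ qPos a × qPos a < q
  qPos-range {a} p≤a a<N =
    ℕ.m<n⇒0<n∸m p≤a ,
    subst (qPos a <_) (ℕ.m+n∸m≡n (p ∸ 1) q) (ℕ.∸-monoˡ-< a<N (ℕ.≤-trans (ℕ.n≤1+n (p ∸ 1)) p≤a))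

module CoreLaplacian (p' q' s c : ℕ) where

  open import Data.Nat as ℕ using (zero; suc; _∸_; _≤_; _<_; z≤n; s≤s; _≡ᵇ_)
  import Data.Nat.Properties as ℕ
  open import Data.Rational using (ℚ; 0ℚ; 1ℚ; _+_; _-_)
  open import Data.Rational.Solver using (module +-*-Solver)
  open +-*-Solver
  open import Data.Product using (proj₁; proj₂)
  open import Relation.Nullary using (Dec; yes; no)
  open import Relation.Binary.PropositionalEquality
  open ≡-Reasoning
  open import Defs
  open FiniteSums
  open CycleGreen
  open CoreGreen p' q' s c

  coreLaplacian : (ℕ → ℚ) → ℕ → ℚ
  coreLaplacian h v = coreΣ v (λ y → h v - h y)

  private
    cong-diff₂ : ∀ {a b c d a′ b′ c′ d′ : ℚ} → a ≡ a′ → b ≡ b′ → c ≡ c′ → d ≡ d′ →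
                 (a - b) + (c - d) ≡ (a′ - b′) + (c′ - d′)
    cong-diff₂ refl refl refl refl = refl

    cong-diff₄ : ∀ {a b c d e a′ b′ c′ d′ e′ : ℚ} → a ≡ a′ → b ≡ b′ → c ≡ c′ → d ≡ d′ → e ≡ e′ →
                 (a - b) + (a - c) + (a - d) + (a - e) ≡ (a′ - b′) + (a′ - c′) + (a′ - d′) + (a′ - e′)
    cong-diff₄ refl refl refl refl refl = refl

    x≡x-0 : ∀ x → x ≡ x - 0ℚ
    x≡x-0 x = solve 1 (λ x → x := x :- con 0ℚ) refl x

    δ-δ-off : ∀ v a → v ≢ a → v ≢ 0 → δ v a - δ v 0 ≡ 0ℚ
    δ-δ-off v a v≢a v≢0 rewrite ≢⇒≡ᵇ-false v≢a | ≢⇒≡ᵇ-false v≢0 = refl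

    1<p : 1 < p
    1<p = s≤s (s≤s z≤n)

    p∸1<p : p ∸ 1 < p
    p∸1<p = ℕ.n<1+n (p ∸ 1)

  coreLaplacian-w-source : ∀ v → coreLaplacian (coreGreen 0) v ≡ δ v 0 - δ v 0
  coreLaplacian-w-source v =
    trans (Σ-cong N (λ y _ → trans (cong (ind (adj Gr v y)) (cong₂ _-_ (coreGreen-wˡ v) (coreGreen-wˡ y))) (ind-0 (adj Gr v y))))
          (trans (Σ-zero N) (sym (solve 1 (λ x → x :- x := con 0ℚ) refl (δ v 0))))

  coreLaplacian-p-source : ∀ a → 1 ≤ a → a < p → ∀ v → v < N → coreLaplacian (coreGreen a) v ≡ δ v a - δ v 0
  coreLaplacian-p-source a 1≤a a<p v v<N = at v (coreVertex v v<N)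
    where
    h = coreGreen a
    G = cycleGreen p⁻¹ a
    hQ : ∀ {y} → p ≤ y → h y ≡ 0ℚ
    hQ = coreGreen-pq a<p
    at : ∀ v → CoreVertex v → coreLaplacian h v ≡ δ v a - δ v 0
    at _ (at-w refl) = begin
      coreLaplacian h 0
        ≡⟨ coreΣ-w (λ y → h 0 - h y) ⟩
      (h 0 - h 1) + (h 0 - h (p ∸ 1)) + (h 0 - h p) + (h 0 - h M)
        ≡⟨ cong-diff₄ (coreGreen-wʳ a) (coreGreen-pp a<p 1<p) (coreGreen-pp a<p p∸1<p) (hQ ℕ.≤-refl) (hQ (ℕ.<⇒≤ p<M)) ⟩
      (0ℚ - G 1) + (0ℚ - G (p ∸ 1)) + (0ℚ - 0ℚ) + (0ℚ - 0ℚ)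
        ≡⟨ solve 2 (λ x y → (con 0ℚ :- x) :+ (con 0ℚ :- y) :+ (con 0ℚ :- con 0ℚ) :+ (con 0ℚ :- con 0ℚ)
                            := con 0ℚ :- (x :+ y)) refl (G 1) (G (p ∸ 1)) ⟩
      0ℚ - (G 1 + G (p ∸ 1))
        ≡⟨ cong (0ℚ -_) (cycleGreen-ends p a (*-inv-suc (suc (suc p'))) 1≤a a<p) ⟩
      0ℚ - 1ℚ
        ≡⟨ cong (λ b → ind b 1ℚ - 1ℚ) (sym (≢⇒≡ᵇ-false (λ 0≡a → ℕ.<⇒≱ 1≤a (ℕ.≤-reflexive (sym 0≡a))))) ⟩
      δ 0 a - δ 0 0 ∎
    at _ (at-p-inner t refl lt) = begin
      coreLaplacian h (suc t)
        ≡⟨ coreΣ-p-inner t (λ y → h (suc t) - h y) lt ⟩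
      (h (suc t) - h t) + (h (suc t) - h (suc (suc t)))
        ≡⟨ cong-diff₂ (coreGreen-pp a<p t+1<p) (coreGreen-pp a<p (ℕ.<-trans (ℕ.n<1+n t) t+1<p))
                      (coreGreen-pp a<p t+1<p) (coreGreen-pp a<p lt) ⟩
      (G (suc t) - G t) + (G (suc t) - G (suc (suc t)))
        ≡⟨ cycleGreen-second-difference p⁻¹ a t ⟩
      δ (suc t) a
        ≡⟨ x≡x-0 _ ⟩
      δ (suc t) a - δ (suc t) 0 ∎
      where
      t+1<p = ℕ.<-trans (ℕ.n<1+n (suc t)) lt
    at _ (at-p-last refl) = begin
      coreLaplacian h (p ∸ 1)
        ≡⟨ coreΣ-p-last (λ y → h (p ∸ 1) - h y) ⟩
      (h (p ∸ 1) - h (p ∸ 2)) + (h (p ∸ 1) - h 0)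
        ≡⟨ cong-diff₂ (coreGreen-pp a<p p∸1<p) (coreGreen-pp a<p (ℕ.<-trans (ℕ.n<1+n (p ∸ 2)) p∸1<p))
                      (coreGreen-pp a<p p∸1<p) (trans (coreGreen-wʳ a) (sym (cycleGreen-m p a (*-inv-suc (suc (suc p'))) (ℕ.<⇒≤ a<p)))) ⟩
      (G (p ∸ 1) - G (p ∸ 2)) + (G (p ∸ 1) - G p)
        ≡⟨ cycleGreen-second-difference p⁻¹ a (p ∸ 2) ⟩
      δ (p ∸ 1) a
        ≡⟨ x≡x-0 _ ⟩
      δ (p ∸ 1) a - δ (p ∸ 1) 0 ∎
    at _ (at-q-first refl) =
      trans (coreΣ-q-first (λ y → h p - h y))
            (trans (cong-diff₂ (hQ ℕ.≤-refl) (coreGreen-wʳ a) (hQ ℕ.≤-refl) (hQ (ℕ.n≤1+n p)))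
                   (sym (δ-δ-off p a (λ e → ℕ.<-irrefl (sym e) a<p) (λ ()))))
    at _ (at-q-inner t refl p≤t lt) =
      trans (coreΣ-q-inner t (λ y → h (suc t) - h y) p≤t lt)
            (trans (cong-diff₂ (hQ p≤t+1) (hQ p≤t) (hQ p≤t+1) (hQ (ℕ.≤-trans p≤t+1 (ℕ.n≤1+n (suc t)))))
                   (sym (δ-δ-off (suc t) a (λ e → ℕ.<⇒≱ (subst (_< p) (sym e) a<p) p≤t+1) (λ ()))))
      where
      p≤t+1 = ℕ.≤-trans p≤t (ℕ.n≤1+n t)
    at _ (at-q-last refl) =
      trans (coreΣ-q-last (λ y → h M - h y))
            (trans (cong-diff₂ (hQ (ℕ.<⇒≤ p<M)) (hQ p≤M∸1) (hQ (ℕ.<⇒≤ p<M)) (coreGreen-wʳ a))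
                   (sym (δ-δ-off M a (λ e → ℕ.<⇒≱ (subst (_< p) (sym e) a<p) (ℕ.<⇒≤ p<M)) (λ ()))))

  coreLaplacian-q-source : ∀ a → p ≤ a → a < N → ∀ v → v < N → coreLaplacian (coreGreen a) v ≡ δ v a - δ v 0
  coreLaplacian-q-source a p≤a a<N v v<N = at v (coreVertex v v<N)
    where
    h = coreGreen a
    i = qPos a
    G = cycleGreen q⁻¹ i
    i-range = qPos-range p≤a a<N
    hP : ∀ {y} → y < p → h y ≡ 0ℚ
    hP = coreGreen-qp p≤a
    hQ : ∀ {y} → p ≤ y → h y ≡ G (qPos y)
    hQ = coreGreen-qq p≤a
    p∸1≤ : ∀ {y} → p ≤ y → p ∸ 1 ≤ y
    p∸1≤ p≤y = ℕ.≤-trans (ℕ.n≤1+n (p ∸ 1)) p≤y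
    a∉Cp : ∀ {y} → y < p → y ≢ a
    a∉Cp y<p y≡a = ℕ.<⇒≱ (subst (_< p) y≡a y<p) p≤a
    at : ∀ v → CoreVertex v → coreLaplacian h v ≡ δ v a - δ v 0
    at _ (at-w refl) = begin
      coreLaplacian h 0
        ≡⟨ coreΣ-w (λ y → h 0 - h y) ⟩
      (h 0 - h 1) + (h 0 - h (p ∸ 1)) + (h 0 - h p) + (h 0 - h M)
        ≡⟨ cong-diff₄ (hP (s≤s z≤n)) (hP 1<p) (hP p∸1<p) (trans (hQ ℕ.≤-refl) (cong G qPos-p))
                      (trans (hQ (ℕ.<⇒≤ p<M)) (cong G qPos-M)) ⟩
      (0ℚ - 0ℚ) + (0ℚ - 0ℚ) + (0ℚ - G 1) + (0ℚ - G (q ∸ 1))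
        ≡⟨ solve 2 (λ x y → (con 0ℚ :- con 0ℚ) :+ (con 0ℚ :- con 0ℚ) :+ (con 0ℚ :- x) :+ (con 0ℚ :- y)
                            := con 0ℚ :- (x :+ y)) refl (G 1) (G (q ∸ 1)) ⟩
      0ℚ - (G 1 + G (q ∸ 1))
        ≡⟨ cong (0ℚ -_) (cycleGreen-ends q i (*-inv-suc (suc (suc q'))) (proj₁ i-range) (proj₂ i-range)) ⟩
      0ℚ - 1ℚ
        ≡⟨ cong (λ b → ind b 1ℚ - 1ℚ) (sym (≢⇒≡ᵇ-false (a∉Cp (s≤s z≤n)))) ⟩
      δ 0 a - δ 0 0 ∎
    at _ (at-p-inner t refl lt) =
      trans (coreΣ-p-inner t (λ y → h (suc t) - h y) lt)
            (trans (cong-diff₂ (hP t+1<p) (hP (ℕ.<-trans (ℕ.n<1+n t) t+1<p)) (hP t+1<p) (hP lt))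
                   (sym (δ-δ-off (suc t) a (a∉Cp t+1<p) (λ ()))))
      where
      t+1<p = ℕ.<-trans (ℕ.n<1+n (suc t)) lt
    at _ (at-p-last refl) =
      trans (coreΣ-p-last (λ y → h (p ∸ 1) - h y))
            (trans (cong-diff₂ (hP p∸1<p) (hP (ℕ.<-trans (ℕ.n<1+n (p ∸ 2)) p∸1<p)) (hP p∸1<p) (hP (s≤s z≤n)))
                   (sym (δ-δ-off (p ∸ 1) a (a∉Cp p∸1<p) (λ ()))))
    at _ (at-q-first refl) = begin
      coreLaplacian h p
        ≡⟨ coreΣ-q-first (λ y → h p - h y) ⟩
      (h p - h 0) + (h p - h (suc p))
        ≡⟨ cong-diff₂ h-p (trans (hP (s≤s z≤n)) (sym (cycleGreen-0ʳ q⁻¹ i))) h-p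
                      (trans (hQ (ℕ.n≤1+n p)) (cong G (trans (qPos-suc (p∸1≤ ℕ.≤-refl)) (cong suc qPos-p)))) ⟩
      (G 1 - G 0) + (G 1 - G 2)
        ≡⟨ cycleGreen-second-difference q⁻¹ i 0 ⟩
      ind (1 ≡ᵇ i) 1ℚ
        ≡⟨ cong (λ b → ind b 1ℚ) (sym (trans (qPos-≡ᵇ (p∸1≤ ℕ.≤-refl) (p∸1≤ p≤a)) (cong (_≡ᵇ i) qPos-p))) ⟩
      δ p a
        ≡⟨ x≡x-0 _ ⟩
      δ p a - δ p 0 ∎
      where
      h-p : h p ≡ G 1
      h-p = trans (hQ ℕ.≤-refl) (cong G qPos-p)
    at _ (at-q-inner t refl p≤t lt) = begin
      coreLaplacian h (suc t)
        ≡⟨ coreΣ-q-inner t (λ y → h (suc t) - h y) p≤t lt ⟩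
      (h (suc t) - h t) + (h (suc t) - h (suc (suc t)))
        ≡⟨ cong-diff₂ h-t+1 (hQ p≤t) h-t+1
                      (trans (hQ (ℕ.≤-trans p≤t+1 (ℕ.n≤1+n (suc t))))
                             (cong G (trans (qPos-suc (p∸1≤ p≤t+1)) (cong suc (qPos-suc (p∸1≤ p≤t)))))) ⟩
      (G (suc τ) - G τ) + (G (suc τ) - G (suc (suc τ)))
        ≡⟨ cycleGreen-second-difference q⁻¹ i τ ⟩
      ind (suc τ ≡ᵇ i) 1ℚ
        ≡⟨ cong (λ b → ind b 1ℚ) (sym (trans (qPos-≡ᵇ (p∸1≤ p≤t+1) (p∸1≤ p≤a)) (cong (_≡ᵇ i) (qPos-suc (p∸1≤ p≤t))))) ⟩
      δ (suc t) a
        ≡⟨ x≡x-0 _ ⟩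
      δ (suc t) a - δ (suc t) 0 ∎
      where
      τ = qPos t
      p≤t+1 = ℕ.≤-trans p≤t (ℕ.n≤1+n t)
      h-t+1 : h (suc t) ≡ G (suc τ)
      h-t+1 = trans (hQ p≤t+1) (cong G (qPos-suc (p∸1≤ p≤t)))
    at _ (at-q-last refl) = begin
      coreLaplacian h M
        ≡⟨ coreΣ-q-last (λ y → h M - h y) ⟩
      (h M - h (M ∸ 1)) + (h M - h 0)
        ≡⟨ cong-diff₂ h-M (trans (hQ p≤M∸1) (cong G qPos-M∸1)) h-M
                      (trans (hP (s≤s z≤n)) (sym (cycleGreen-m q i (*-inv-suc (suc (suc q'))) (ℕ.<⇒≤ (proj₂ i-range))))) ⟩
      (G (q ∸ 1) - G (q ∸ 2)) + (G (q ∸ 1) - G q)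
        ≡⟨ cycleGreen-second-difference q⁻¹ i (q ∸ 2) ⟩
      ind (q ∸ 1 ≡ᵇ i) 1ℚ
        ≡⟨ cong (λ b → ind b 1ℚ) (sym (trans (qPos-≡ᵇ (p∸1≤ (ℕ.<⇒≤ p<M)) (p∸1≤ p≤a)) (cong (_≡ᵇ i) qPos-M))) ⟩
      δ M a
        ≡⟨ x≡x-0 _ ⟩
      δ M a - δ M 0 ∎
      where
      h-M : h M ≡ G (q ∸ 1)
      h-M = trans (hQ (ℕ.<⇒≤ p<M)) (cong G qPos-M)

  coreLaplacian-coreGreen : ∀ a v → a < N → v < N → coreLaplacian (coreGreen a) v ≡ δ v a - δ v 0
  coreLaplacian-coreGreen zero    v _   _   = coreLaplacian-w-source v
  coreLaplacian-coreGreen (suc a) v a<N v<N = by-block (suc a ℕ.<? p)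
    where
    by-block : Dec (suc a < p) → coreLaplacian (coreGreen (suc a)) v ≡ δ v (suc a) - δ v 0
    by-block (yes a<p) = coreLaplacian-p-source (suc a) (s≤s z≤n) a<p v v<N
    by-block (no a≮p)  = coreLaplacian-q-source (suc a) (ℕ.≮⇒≥ a≮p) a<N v v<N

module Potential (p' q' s c : ℕ) where

  open import Data.Bool using (true; false; _∧_; if_then_else_)
  open import Data.Bool.Properties using (∧-zeroʳ; ∧-identityʳ)
  open import Data.Nat as ℕ using (_∸_; _≤_; _<_; z≤n; s≤s; _≡ᵇ_; _<ᵇ_; _≤ᵇ_)
  import Data.Nat.Properties as ℕ
  open import Data.Rational using (ℚ; 0ℚ; 1ℚ; _+_; _-_)
  open import Data.Rational.Properties using (+-identityʳ)
  open import Data.Rational.Solver using (module +-*-Solver)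
  open +-*-Solver
  open import Data.Product using (_,_)
  open import Relation.Nullary using (Dec; yes; no; ¬_)
  open import Relation.Binary.PropositionalEquality
  open ≡-Reasoning
  open import Defs
  open FiniteSums
  open Resistance using (laplacian-+; laplacian-diff)
  open CoreLaplacian p' q' s c public
  open CoreGreen p' q' s c public

  toCore : ℕ → ℕ
  toCore z = if z <ᵇ N then z else c

  toCore-core : ∀ {z} → z < N → toCore z ≡ z
  toCore-core {z} z<N rewrite T⇒≡true (ℕ.<⇒<ᵇ z<N) = refl

  toCore-pendant : ∀ {z} → N ≤ z → toCore z ≡ c
  toCore-pendant {z} N≤z rewrite ¬T⇒≡false {z <ᵇ N} (λ t → ℕ.<⇒≱ (ℕ.<ᵇ⇒< _ _ t) N≤z) = refl

  pendantBump : ℕ → ℕ → ℚ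
  pendantBump x z = ind ((z ≡ᵇ x) ∧ (N ≤ᵇ x)) 1ℚ

  pendantBump-core : ∀ x → x < N → ∀ z → pendantBump x z ≡ 0ℚ
  pendantBump-core x x<N z = cong (λ b → ind b 1ℚ)
    (trans (cong ((z ≡ᵇ x) ∧_) (¬T⇒≡false (λ t → ℕ.<⇒≱ x<N (ℕ.≤ᵇ⇒≤ _ _ t)))) (∧-zeroʳ (z ≡ᵇ x)))

  pendantBump-pendant : ∀ x → N ≤ x → ∀ z → pendantBump x z ≡ δ z x
  pendantBump-pendant x N≤x z = cong (λ b → ind b 1ℚ)
    (trans (cong ((z ≡ᵇ x) ∧_) (T⇒≡true (ℕ.≤⇒≤ᵇ N≤x))) (∧-identityʳ (z ≡ᵇ x)))

  -- A unit current from x to w only flows through the core: a pendant vertex sits at the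
  -- potential of c, except the source x itself, one unit resistor higher.
  potential : ℕ → ℕ → ℚ
  potential x z = coreGreen (toCore x) (toCore z) + pendantBump x z

  -- Superposition of the currents x → w and w → y.
  resistance : ℕ → ℕ → ℚ
  resistance x y = potential x x - potential y x - (potential x y - potential y y)

  module _ (c<N : c < N) where

    private
      pendant-not-core : ∀ {x z} → N ≤ x → z < N → z ≢ x
      pendant-not-core N≤x z<N z≡x = ℕ.<⇒≱ (subst (_< N) z≡x z<N) N≤x

      bump-pendant-at-core : ∀ x → N ≤ x → ∀ z → z < N → pendantBump x z ≡ 0ℚ
      bump-pendant-at-core x N≤x z z<N =
        trans (pendantBump-pendant x N≤x z) (cong (λ b → ind b 1ℚ) (≢⇒≡ᵇ-false (pendant-not-core N≤x z<N)))

    laplacian-∘toCore-core : ∀ (h : ℕ → ℚ) v → v < N → laplacian Gr (λ z → h (toCore z)) v ≡ coreLaplacian h v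
    laplacian-∘toCore-core h v v<N = begin
      laplacian Gr (λ z → h (toCore z)) v
        ≡⟨ Σ-neighbours-core c<N v (λ y → h (toCore v) - h (toCore y)) ⟩
      coreΣ v (λ y → h (toCore v) - h (toCore y)) + ind (v ≡ᵇ c) (Σ[< s ] (λ i → h (toCore v) - h (toCore (N ℕ.+ i))))
        ≡⟨ cong₂ _+_ (Σ-cong N (λ y y<N → cong (ind (adj Gr v y)) (cong₂ (λ a b → h a - h b) (toCore-core v<N) (toCore-core y<N))))
                     (at-c (v ℕ.≟ c)) ⟩
      coreLaplacian h v + 0ℚ
        ≡⟨ +-identityʳ _ ⟩
      coreLaplacian h v ∎
      where
      at-c : Dec (v ≡ c) → ind (v ≡ᵇ c) (Σ[< s ] (λ i → h (toCore v) - h (toCore (N ℕ.+ i)))) ≡ 0ℚ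
      at-c (yes refl) =
        trans (cong (ind (v ≡ᵇ v))
                 (trans (Σ-cong s (λ i _ → trans (cong₂ (λ a b → h a - h b) (toCore-core v<N) (toCore-pendant (ℕ.m≤m+n N i)))
                                                  (solve 1 (λ x → x :- x := con 0ℚ) refl (h v))))
                        (Σ-zero s)))
              (ind-0 _)
      at-c (no v≢c) = cong (λ b → ind b (Σ[< s ] (λ i → h (toCore v) - h (toCore (N ℕ.+ i))))) (≢⇒≡ᵇ-false v≢c)

    laplacian-∘toCore-pendant : ∀ (h : ℕ → ℚ) v → N ≤ v → v < n → laplacian Gr (λ z → h (toCore z)) v ≡ 0ℚ
    laplacian-∘toCore-pendant h v N≤v v<n =
      trans (Σ-neighbours-pendant c<N v (λ y → h (toCore v) - h (toCore y)) N≤v v<n)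
            (trans (cong₂ (λ a b → h a - h b) (toCore-pendant N≤v) (toCore-core c<N))
                   (solve 1 (λ x → x :- x := con 0ℚ) refl (h c)))

    laplacian-bump-core-source : ∀ x v → x < N → laplacian Gr (pendantBump x) v ≡ 0ℚ
    laplacian-bump-core-source x v x<N =
      trans (Σ-cong n (λ y _ → trans (cong (ind (adj Gr v y)) (cong₂ _-_ (pendantBump-core x x<N v) (pendantBump-core x x<N y)))
                                     (ind-0 _)))
            (Σ-zero n)

    laplacian-bump-at-core : ∀ x v → N ≤ x → x < n → v < N → laplacian Gr (pendantBump x) v ≡ 0ℚ - δ v c
    laplacian-bump-at-core x v N≤x x<n v<N = begin
      laplacian Gr (pendantBump x) v
        ≡⟨ Σ-neighbours-core c<N v (λ y → pendantBump x v - pendantBump x y) ⟩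
      coreΣ v (λ y → pendantBump x v - pendantBump x y) + ind (v ≡ᵇ c) (Σ[< s ] (λ i → pendantBump x v - pendantBump x (N ℕ.+ i)))
        ≡⟨ cong₂ _+_
             (trans (Σ-cong N (λ y y<N → trans (cong (ind (adj Gr v y)) (cong₂ _-_ (at-core v v<N) (at-core y y<N))) (ind-0 _)))
                    (Σ-zero N))
             (cong (ind (v ≡ᵇ c))
                (trans (Σ-cong s (λ i _ → cong₂ _-_ (at-core v v<N) (pendantBump-pendant x N≤x (N ℕ.+ i))))
                       (trans (Σ-distrib-diff s _ _) (cong₂ _-_ (Σ-zero s) Σ-δ-pendants)))) ⟩
      0ℚ + ind (v ≡ᵇ c) (0ℚ - 1ℚ)
        ≡⟨ ind-neg (v ≡ᵇ c) ⟩
      0ℚ - δ v c ∎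
      where
      at-core : ∀ z → z < N → pendantBump x z ≡ 0ℚ
      at-core = bump-pendant-at-core x N≤x
      Σ-δ-pendants : Σ[< s ] (λ i → δ (N ℕ.+ i) x) ≡ 1ℚ
      Σ-δ-pendants =
        trans (Σ-single s (x ∸ N) (λ i → δ (N ℕ.+ i) x)
                (subst (x ∸ N <_) (ℕ.m+n∸m≡n N s) (ℕ.∸-monoˡ-< x<n N≤x))
                (λ i _ i≢x∸N → cong (λ b → ind b 1ℚ)
                   (≢⇒≡ᵇ-false {N ℕ.+ i} {x} (λ e → i≢x∸N (trans (sym (ℕ.m+n∸m≡n N i)) (cong (_∸ N) e))))))
              (cong (λ b → ind b 1ℚ) (T⇒≡true (ℕ.≡⇒≡ᵇ _ _ (ℕ.m+[n∸m]≡n N≤x))))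
      ind-neg : ∀ b → 0ℚ + ind b (0ℚ - 1ℚ) ≡ 0ℚ - ind b 1ℚ
      ind-neg true  = refl
      ind-neg false = refl

    laplacian-bump-at-pendant : ∀ x v → N ≤ x → N ≤ v → v < n → laplacian Gr (pendantBump x) v ≡ δ v x
    laplacian-bump-at-pendant x v N≤x N≤v v<n =
      trans (Σ-neighbours-pendant c<N v (λ y → pendantBump x v - pendantBump x y) N≤v v<n)
            (trans (cong₂ _-_ (pendantBump-pendant x N≤x v) (bump-pendant-at-core x N≤x c c<N))
                   (solve 1 (λ x → x :- con 0ℚ := x) refl (δ v x)))

    laplacian-potential : ∀ x v → x < n → v < n → laplacian Gr (potential x) v ≡ δ v x - δ v 0
    laplacian-potential x v x<n v<n =
      trans (laplacian-+ Gr (λ z → coreGreen (toCore x) (toCore z)) (pendantBump x) v)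
            (by-cases (x ℕ.<? N) (v ℕ.<? N))
      where
      core-part = laplacian Gr (λ z → coreGreen (toCore x) (toCore z)) v
      bump-part = laplacian Gr (pendantBump x) v
      v≢0 : ¬ v < N → v ≢ 0
      v≢0 v≮N v≡0 = v≮N (subst (_< N) (sym v≡0) (s≤s z≤n))
      by-cases : Dec (x < N) → Dec (v < N) → core-part + bump-part ≡ δ v x - δ v 0
      by-cases (yes x<N) (yes v<N) = begin
        core-part + bump-part
          ≡⟨ cong₂ _+_ (laplacian-∘toCore-core (coreGreen (toCore x)) v v<N) (laplacian-bump-core-source x v x<N) ⟩
        coreLaplacian (coreGreen (toCore x)) v + 0ℚ
          ≡⟨ +-identityʳ _ ⟩
        coreLaplacian (coreGreen (toCore x)) v
          ≡⟨ cong (λ z → coreLaplacian (coreGreen z) v) (toCore-core x<N) ⟩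
        coreLaplacian (coreGreen x) v
          ≡⟨ coreLaplacian-coreGreen x v x<N v<N ⟩
        δ v x - δ v 0 ∎
      by-cases (yes x<N) (no v≮N) = begin
        core-part + bump-part
          ≡⟨ cong₂ _+_ (laplacian-∘toCore-pendant (coreGreen (toCore x)) v (ℕ.≮⇒≥ v≮N) v<n) (laplacian-bump-core-source x v x<N) ⟩
        0ℚ + 0ℚ
          ≡⟨ sym (cong₂ (λ a b → ind a 1ℚ - ind b 1ℚ) (≢⇒≡ᵇ-false (λ v≡x → v≮N (subst (_< N) (sym v≡x) x<N))) (≢⇒≡ᵇ-false (v≢0 v≮N))) ⟩
        δ v x - δ v 0 ∎
      by-cases (no x≮N) (yes v<N) = begin
        core-part + bump-part
          ≡⟨ cong₂ _+_ (laplacian-∘toCore-core (coreGreen (toCore x)) v v<N) (laplacian-bump-at-core x v (ℕ.≮⇒≥ x≮N) x<n v<N) ⟩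
        coreLaplacian (coreGreen (toCore x)) v + (0ℚ - δ v c)
          ≡⟨ cong (λ z → coreLaplacian (coreGreen z) v + (0ℚ - δ v c)) (toCore-pendant (ℕ.≮⇒≥ x≮N)) ⟩
        coreLaplacian (coreGreen c) v + (0ℚ - δ v c)
          ≡⟨ cong (_+ (0ℚ - δ v c)) (coreLaplacian-coreGreen c v c<N v<N) ⟩
        (δ v c - δ v 0) + (0ℚ - δ v c)
          ≡⟨ solve 2 (λ a b → (a :- b) :+ (con 0ℚ :- a) := con 0ℚ :- b) refl (δ v c) (δ v 0) ⟩
        0ℚ - δ v 0
          ≡⟨ cong (λ b → ind b 1ℚ - δ v 0) (sym (≢⇒≡ᵇ-false (pendant-not-core (ℕ.≮⇒≥ x≮N) v<N))) ⟩
        δ v x - δ v 0 ∎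
      by-cases (no x≮N) (no v≮N) = begin
        core-part + bump-part
          ≡⟨ cong₂ _+_ (laplacian-∘toCore-pendant (coreGreen (toCore x)) v (ℕ.≮⇒≥ v≮N) v<n)
                       (laplacian-bump-at-pendant x v (ℕ.≮⇒≥ x≮N) (ℕ.≮⇒≥ v≮N) v<n) ⟩
        0ℚ + δ v x
          ≡⟨ solve 1 (λ a → con 0ℚ :+ a := a :- con 0ℚ) refl (δ v x) ⟩
        δ v x - 0ℚ
          ≡⟨ cong (λ b → δ v x - ind b 1ℚ) (sym (≢⇒≡ᵇ-false (v≢0 v≮N))) ⟩
        δ v x - δ v 0 ∎

    resistance-isResistanceDistance : IsResistanceDistance Gr resistance
    resistance-isResistanceDistance x y x<n y<n =
      (λ z → potential x z - potential y z) ,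
      (λ v v<n → trans (laplacian-diff Gr (potential x) (potential y) v)
                   (trans (cong₂ _-_ (laplacian-potential x v x<n v<n) (laplacian-potential y v y<n v<n))
                          (solve 3 (λ a b c → (a :- c) :- (b :- c) := a :- b) refl (δ v x) (δ v y) (δ v 0)))) ,
      refl

module DegreeResistanceFormula (p' q' s c : ℕ) where

  open import Data.Bool using (true; false)
  open import Data.Nat as ℕ using (_≤_; _<_; _≡ᵇ_; _<ᵇ_)
  import Data.Nat.Properties as ℕ
  open import Data.Rational using (ℚ; 0ℚ; 1ℚ; _+_; _-_; _*_)
  open import Data.Rational.Properties using (+-identityʳ; +-identityˡ)
  open import Data.Rational.Solver using (module +-*-Solver)
  open +-*-Solver
  open import Relation.Nullary using (Dec; yes; no)
  open import Relation.Binary.Definitions using (Tri; tri<; tri≈; tri>)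
  open import Relation.Binary.PropositionalEquality
  open import Function using (_∘_)
  open ≡-Reasoning
  open import Defs
  open NatCast
  open FiniteSums
  open Potential p' q' s c public

  S : ℚ
  S = ℕtoℚ s

  coreResistance : ℕ → ℕ → ℚ
  coreResistance a b = coreGreen a a - coreGreen b a - (coreGreen a b - coreGreen b b)

  coreResistance-sym : ∀ a b → coreResistance a b ≡ coreResistance b a
  coreResistance-sym a b = begin
    coreGreen a a - coreGreen b a - (coreGreen a b - coreGreen b b)
      ≡⟨ cong (λ z → coreGreen a a - coreGreen b a - (z - coreGreen b b)) (coreGreen-sym a b) ⟩
    coreGreen a a - coreGreen b a - (coreGreen b a - coreGreen b b)
      ≡⟨ solve 3 (λ x y z → x :- y :- (y :- z) := z :- y :- (y :- x)) refl (coreGreen a a) (coreGreen b a) (coreGreen b b) ⟩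
    coreGreen b b - coreGreen b a - (coreGreen b a - coreGreen a a)
      ≡⟨ cong (λ z → coreGreen b b - z - (coreGreen b a - coreGreen a a)) (sym (coreGreen-sym a b)) ⟩
    coreGreen b b - coreGreen a b - (coreGreen b a - coreGreen a a) ∎

  coreResistance-self : ∀ a → coreResistance a a ≡ 0ℚ
  coreResistance-self a = solve 1 (λ x → x :- x :- (x :- x) := con 0ℚ) refl (coreGreen a a)

  coreTerms : ℚ
  coreTerms = Σ[< N ] (λ x → Σ[< N ] (λ y →
                ind (x <ᵇ y) ((ℕtoℚ (coreDegree x) + ℕtoℚ (coreDegree y)) * coreResistance x y)))

  pendantTerm : ℕ → ℕ → ℚ
  pendantTerm x y = ind (x <ᵇ y) ((1ℚ + 1ℚ) * (1ℚ + 1ℚ))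

  pendantTerms : ℚ
  pendantTerms = Σ[< s ] (λ i → Σ[< s ] (λ j → pendantTerm (N ℕ.+ i) (N ℕ.+ j)))

  baseline : ℚ
  baseline = coreTerms + S * Σ[< N ] (λ x → ℕtoℚ (coreDegree x) + 1ℚ) + S * S + pendantTerms

  weight : ℕ → ℚ
  weight x = ℕtoℚ (coreDegree x) + ℕtoℚ 2

  attachmentCost : ℚ
  attachmentCost = Σ[< N ] (λ x → weight x * coreResistance c x)

  private
    <ᵇ-true : ∀ {a b} → a < b → (a <ᵇ b) ≡ true
    <ᵇ-true a<b = T⇒≡true (ℕ.<⇒<ᵇ a<b)
    <ᵇ-false : ∀ {a b} → b ≤ a → (a <ᵇ b) ≡ false
    <ᵇ-false b≤a = ¬T⇒≡false (λ t → ℕ.<⇒≱ (ℕ.<ᵇ⇒< _ _ t) b≤a)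

    split-degree-term : ∀ b₁ b₂ b₃ (a e r S : ℚ) →
      ind b₁ ((a + ind b₂ S + (e + ind b₃ S)) * r) ≡ ind b₁ ((a + e) * r) + S * (ind b₂ (ind b₁ r) + ind b₃ (ind b₁ r))
    split-degree-term true  true  true  a e r S =
      solve 4 (λ a e r S → (a :+ S :+ (e :+ S)) :* r := (a :+ e) :* r :+ S :* (r :+ r)) refl a e r S
    split-degree-term true  true  false a e r S =
      solve 4 (λ a e r S → (a :+ S :+ (e :+ con 0ℚ)) :* r := (a :+ e) :* r :+ S :* (r :+ con 0ℚ)) refl a e r S
    split-degree-term true  false true  a e r S =
      solve 4 (λ a e r S → (a :+ con 0ℚ :+ (e :+ S)) :* r := (a :+ e) :* r :+ S :* (con 0ℚ :+ r)) refl a e r S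
    split-degree-term true  false false a e r S =
      solve 4 (λ a e r S → (a :+ con 0ℚ :+ (e :+ con 0ℚ)) :* r := (a :+ e) :* r :+ S :* (con 0ℚ :+ con 0ℚ)) refl a e r S
    split-degree-term false b₂ b₃ a e r S = begin
      0ℚ                                            ≡⟨ solve 1 (λ S → con 0ℚ := con 0ℚ :+ S :* (con 0ℚ :+ con 0ℚ)) refl S ⟩
      0ℚ + S * (0ℚ + 0ℚ)                            ≡⟨ sym (cong₂ (λ x y → 0ℚ + S * (x + y)) (ind-0 b₂) (ind-0 b₃)) ⟩
      0ℚ + S * (ind b₂ 0ℚ + ind b₃ 0ℚ)              ∎

    Σ-+-* : ∀ n (f g h : ℕ → ℚ) (S : ℚ) → Σ[< n ] (λ x → f x + S * (g x + h x)) ≡ Σ[< n ] f + S * (Σ[< n ] g + Σ[< n ] h)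
    Σ-+-* n f g h S =
      trans (Σ-distrib-+ n f (λ x → S * (g x + h x))) (cong (Σ[< n ] f +_) (trans (Σ-*ˡ n S (λ x → g x + h x)) (cong (S *_) (Σ-distrib-+ n g h))))

  module _ (c<N : c < N) where

    private
      potential-core-core : ∀ {x z} → x < N → z < N → potential x z ≡ coreGreen x z
      potential-core-core {x} {z} x<N z<N =
        trans (cong₂ _+_ (cong₂ coreGreen (toCore-core x<N) (toCore-core z<N)) (pendantBump-core x x<N z)) (+-identityʳ _)

      potential-core-pendant : ∀ {x z} → x < N → N ≤ z → potential x z ≡ coreGreen x c
      potential-core-pendant {x} {z} x<N N≤z =
        trans (cong₂ _+_ (cong₂ coreGreen (toCore-core x<N) (toCore-pendant N≤z)) (pendantBump-core x x<N z)) (+-identityʳ _)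

      potential-pendant-core : ∀ {x z} → N ≤ x → z < N → potential x z ≡ coreGreen c z
      potential-pendant-core {x} {z} N≤x z<N =
        trans (cong₂ _+_ (cong₂ coreGreen (toCore-pendant N≤x) (toCore-core z<N))
                         (trans (pendantBump-pendant x N≤x z)
                                (cong (λ b → ind b 1ℚ) (≢⇒≡ᵇ-false (λ z≡x → ℕ.<⇒≱ (subst (_< N) z≡x z<N) N≤x)))))
              (+-identityʳ _)

      potential-pendant-pendant : ∀ {x z} → N ≤ x → N ≤ z → potential x z ≡ coreGreen c c + δ z x
      potential-pendant-pendant {x} {z} N≤x N≤z =
        cong₂ _+_ (cong₂ coreGreen (toCore-pendant N≤x) (toCore-pendant N≤z)) (pendantBump-pendant x N≤x z)

    resistance-core-core : ∀ {x y} → x < N → y < N → resistance x y ≡ coreResistance x y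
    resistance-core-core x<N y<N =
      cong₂ _-_ (cong₂ _-_ (potential-core-core x<N x<N) (potential-core-core y<N x<N))
                (cong₂ _-_ (potential-core-core x<N y<N) (potential-core-core y<N y<N))

    resistance-core-pendant : ∀ {x y} → x < N → N ≤ y → resistance x y ≡ coreResistance x c + 1ℚ
    resistance-core-pendant {x} {y} x<N N≤y = begin
      resistance x y
        ≡⟨ cong₂ _-_ (cong₂ _-_ (potential-core-core x<N x<N) (potential-pendant-core N≤y x<N))
                     (cong₂ _-_ (potential-core-pendant x<N N≤y) (potential-pendant-pendant N≤y N≤y)) ⟩
      coreGreen x x - coreGreen c x - (coreGreen x c - (coreGreen c c + δ y y))
        ≡⟨ cong (λ b → coreGreen x x - coreGreen c x - (coreGreen x c - (coreGreen c c + ind b 1ℚ))) (≡ᵇ-refl y) ⟩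
      coreGreen x x - coreGreen c x - (coreGreen x c - (coreGreen c c + 1ℚ))
        ≡⟨ solve 4 (λ a b d e → a :- b :- (d :- (e :+ con 1ℚ)) := a :- b :- (d :- e) :+ con 1ℚ) refl
                   (coreGreen x x) (coreGreen c x) (coreGreen x c) (coreGreen c c) ⟩
      coreResistance x c + 1ℚ ∎

    resistance-pendant-pendant : ∀ {x y} → N ≤ x → N ≤ y → x ≢ y → resistance x y ≡ 1ℚ + 1ℚ
    resistance-pendant-pendant {x} {y} N≤x N≤y x≢y = begin
      resistance x y
        ≡⟨ cong₂ _-_ (cong₂ _-_ (potential-pendant-pendant N≤x N≤x) (potential-pendant-pendant N≤y N≤x))
                     (cong₂ _-_ (potential-pendant-pendant N≤x N≤y) (potential-pendant-pendant N≤y N≤y)) ⟩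
      G + δ x x - (G + δ x y) - (G + δ y x - (G + δ y y))
        ≡⟨ cong₂ (λ b₁ b₂ → G + ind b₁ 1ℚ - (G + ind b₂ 1ℚ) - (G + δ y x - (G + δ y y))) (≡ᵇ-refl x) (≢⇒≡ᵇ-false x≢y) ⟩
      G + 1ℚ - (G + 0ℚ) - (G + δ y x - (G + δ y y))
        ≡⟨ cong₂ (λ b₁ b₂ → G + 1ℚ - (G + 0ℚ) - (G + ind b₁ 1ℚ - (G + ind b₂ 1ℚ))) (≢⇒≡ᵇ-false (x≢y ∘ sym)) (≡ᵇ-refl y) ⟩
      G + 1ℚ - (G + 0ℚ) - (G + 0ℚ - (G + 1ℚ))
        ≡⟨ solve 1 (λ g → g :+ con 1ℚ :- (g :+ con 0ℚ) :- (g :+ con 0ℚ :- (g :+ con 1ℚ)) := con 1ℚ :+ con 1ℚ) refl G ⟩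
      1ℚ + 1ℚ ∎
      where G = coreGreen c c

    degreeℚ : ℕ → ℚ
    degreeℚ x = ℕtoℚ (coreDegree x) + ind (x ≡ᵇ c) S

    term : ℕ → ℕ → ℚ
    term x y = ind (x <ᵇ y) (ℕtoℚ (deg Gr x ℕ.+ deg Gr y) * resistance x y)

    row-core : ∀ x → x < N → Σ[< n ] (term x)
               ≡ Σ[< N ] (λ y → ind (x <ᵇ y) ((degreeℚ x + degreeℚ y) * coreResistance x y))
                 + S * ((degreeℚ x + 1ℚ) * (coreResistance x c + 1ℚ))
    row-core x x<N = trans (Σ-split N s (term x)) (cong₂ _+_ (Σ-cong N core-column) (trans (Σ-cong s pendant-column) (Σ-const s _)))
      where
      core-column : ∀ y → y < N → term x y ≡ ind (x <ᵇ y) ((degreeℚ x + degreeℚ y) * coreResistance x y)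
      core-column y y<N = cong (ind (x <ᵇ y))
        (cong₂ _*_ (trans (ℕtoℚ-+ (deg Gr x) (deg Gr y)) (cong₂ _+_ (degree-core c<N x x<N) (degree-core c<N y y<N)))
                   (resistance-core-core x<N y<N))
      pendant-column : ∀ j → j < s → term x (N ℕ.+ j) ≡ (degreeℚ x + 1ℚ) * (coreResistance x c + 1ℚ)
      pendant-column j j<s =
        trans (cong (λ b → ind b (ℕtoℚ (deg Gr x ℕ.+ deg Gr (N ℕ.+ j)) * resistance x (N ℕ.+ j)))
                    (<ᵇ-true (ℕ.<-≤-trans x<N (ℕ.m≤m+n N j))))
              (cong₂ _*_ (trans (ℕtoℚ-+ (deg Gr x) (deg Gr (N ℕ.+ j)))
                                (cong₂ _+_ (degree-core c<N x x<N) (degree-pendant c<N (N ℕ.+ j) (ℕ.m≤m+n N j) (pendant<n j<s))))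
                         (resistance-core-pendant x<N (ℕ.m≤m+n N j)))

    row-pendant : ∀ i → i < s → Σ[< n ] (term (N ℕ.+ i)) ≡ Σ[< s ] (λ j → pendantTerm (N ℕ.+ i) (N ℕ.+ j))
    row-pendant i i<s =
      trans (Σ-split N s (term x))
            (trans (cong₂ _+_ (trans (Σ-cong N core-column) (Σ-zero N)) (Σ-cong s pendant-column)) (+-identityˡ _))
      where
      x = N ℕ.+ i
      N≤x = ℕ.m≤m+n N i
      core-column : ∀ y → y < N → term x y ≡ 0ℚ
      core-column y y<N = cong (λ b → ind b (ℕtoℚ (deg Gr x ℕ.+ deg Gr y) * resistance x y)) (<ᵇ-false (ℕ.≤-trans (ℕ.<⇒≤ y<N) N≤x))
      pendant-column : ∀ j → j < s → term x (N ℕ.+ j) ≡ pendantTerm x (N ℕ.+ j)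
      pendant-column j j<s = by-cases (x ℕ.≟ y)
        where
        y = N ℕ.+ j
        by-cases : Dec (x ≡ y) → term x y ≡ pendantTerm x y
        by-cases (yes x≡y) =
          trans (cong (λ b → ind b (ℕtoℚ (deg Gr x ℕ.+ deg Gr y) * resistance x y)) (<ᵇ-false (ℕ.≤-reflexive (sym x≡y))))
                (sym (cong (λ b → ind b ((1ℚ + 1ℚ) * (1ℚ + 1ℚ))) (<ᵇ-false (ℕ.≤-reflexive (sym x≡y)))))
        by-cases (no x≢y) = cong (ind (x <ᵇ y))
          (cong₂ _*_ (trans (ℕtoℚ-+ (deg Gr x) (deg Gr y))
                            (cong₂ _+_ (degree-pendant c<N x N≤x (pendant<n i<s)) (degree-pendant c<N y (ℕ.m≤m+n N j) (pendant<n j<s))))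
                     (resistance-pendant-pendant N≤x (ℕ.m≤m+n N j) x≢y))

    private
      split-by-order : ∀ y → ind (c <ᵇ y) (coreResistance c y) + ind (y <ᵇ c) (coreResistance y c) ≡ coreResistance c y
      split-by-order y = by-cases (ℕ.<-cmp c y)
        where
        by-cases : Tri (c < y) (c ≡ y) (y < c) → ind (c <ᵇ y) (coreResistance c y) + ind (y <ᵇ c) (coreResistance y c) ≡ coreResistance c y
        by-cases (tri< c<y _ _) =
          trans (cong₂ (λ b₁ b₂ → ind b₁ (coreResistance c y) + ind b₂ (coreResistance y c)) (<ᵇ-true c<y) (<ᵇ-false (ℕ.<⇒≤ c<y)))
                (+-identityʳ _)
        by-cases (tri≈ _ refl _) =
          trans (cong₂ (λ b₁ b₂ → ind b₁ (coreResistance c c) + ind b₂ (coreResistance c c)) (<ᵇ-false {c} ℕ.≤-refl) (<ᵇ-false {c} ℕ.≤-refl))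
                (sym (coreResistance-self c))
        by-cases (tri> _ _ y<c) =
          trans (cong₂ (λ b₁ b₂ → ind b₁ (coreResistance c y) + ind b₂ (coreResistance y c)) (<ᵇ-false (ℕ.<⇒≤ y<c)) (<ᵇ-true y<c))
                (trans (+-identityˡ _) (coreResistance-sym y c))

      Σ-core-block : Σ[< N ] (λ x → Σ[< N ] (λ y → ind (x <ᵇ y) ((degreeℚ x + degreeℚ y) * coreResistance x y)))
                     ≡ coreTerms + S * Σ[< N ] (coreResistance c)
      Σ-core-block = begin
        Σ[< N ] (λ x → Σ[< N ] (λ y → ind (x <ᵇ y) ((degreeℚ x + degreeℚ y) * coreResistance x y)))
          ≡⟨ Σ-cong N (λ x _ → trans (Σ-cong N (λ y _ → split-degree-term (x <ᵇ y) (x ≡ᵇ c) (y ≡ᵇ c)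
                                                          (ℕtoℚ (coreDegree x)) (ℕtoℚ (coreDegree y)) (coreResistance x y) S))
                                     (Σ-+-* N (block x) (row-term x) (column-term x) S)) ⟩
        Σ[< N ] (λ x → Σ[< N ] (λ y → ind (x <ᵇ y) ((ℕtoℚ (coreDegree x) + ℕtoℚ (coreDegree y)) * coreResistance x y))
                       + S * (Σ[< N ] (λ y → ind (x ≡ᵇ c) (ind (x <ᵇ y) (coreResistance x y)))
                              + Σ[< N ] (λ y → ind (y ≡ᵇ c) (ind (x <ᵇ y) (coreResistance x y)))))
          ≡⟨ Σ-+-* N (λ x → Σ[< N ] (block x)) (λ x → Σ[< N ] (row-term x)) (λ x → Σ[< N ] (column-term x)) S ⟩
        coreTerms + S * (row-c + column-c)
          ≡⟨ cong (λ z → coreTerms + S * z)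
               (trans (cong₂ _+_ row-c≡ column-c≡)
                      (trans (sym (Σ-distrib-+ N (λ y → ind (c <ᵇ y) (coreResistance c y)) (λ y → ind (y <ᵇ c) (coreResistance y c))))
                             (Σ-cong N (λ y _ → split-by-order y)))) ⟩
        coreTerms + S * Σ[< N ] (coreResistance c) ∎
        where
        block row-term column-term : ℕ → ℕ → ℚ
        block x y = ind (x <ᵇ y) ((ℕtoℚ (coreDegree x) + ℕtoℚ (coreDegree y)) * coreResistance x y)
        row-term x y = ind (x ≡ᵇ c) (ind (x <ᵇ y) (coreResistance x y))
        column-term x y = ind (y ≡ᵇ c) (ind (x <ᵇ y) (coreResistance x y))
        row-c column-c : ℚ
        row-c = Σ[< N ] (λ x → Σ[< N ] (λ y → ind (x ≡ᵇ c) (ind (x <ᵇ y) (coreResistance x y))))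
        column-c = Σ[< N ] (λ x → Σ[< N ] (λ y → ind (y ≡ᵇ c) (ind (x <ᵇ y) (coreResistance x y))))
        row-c≡ : row-c ≡ Σ[< N ] (λ y → ind (c <ᵇ y) (coreResistance c y))
        row-c≡ = trans (Σ-cong N (λ x _ → Σ-ind N (x ≡ᵇ c) (λ y → ind (x <ᵇ y) (coreResistance x y))))
                       (Σ-at N c (λ x → Σ[< N ] (λ y → ind (x <ᵇ y) (coreResistance x y))) c<N)
        column-c≡ : column-c ≡ Σ[< N ] (λ y → ind (y <ᵇ c) (coreResistance y c))
        column-c≡ = Σ-cong N (λ x _ → Σ-at N c (λ y → ind (x <ᵇ y) (coreResistance x y)) c<N)

      Σ-core-pendant-block : Σ[< N ] (λ x → (degreeℚ x + 1ℚ) * (coreResistance x c + 1ℚ))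
                             ≡ Σ[< N ] (λ x → (ℕtoℚ (coreDegree x) + 1ℚ) * (coreResistance x c + 1ℚ)) + S * (coreResistance c c + 1ℚ)
      Σ-core-pendant-block =
        trans (Σ-cong N (λ x _ → split-at-c (x ≡ᵇ c) (ℕtoℚ (coreDegree x)) (coreResistance x c)))
              (trans (Σ-distrib-+ N (λ x → (ℕtoℚ (coreDegree x) + 1ℚ) * (coreResistance x c + 1ℚ))
                                    (λ x → ind (x ≡ᵇ c) (S * (coreResistance x c + 1ℚ))))
                     (cong (Σ[< N ] (λ x → (ℕtoℚ (coreDegree x) + 1ℚ) * (coreResistance x c + 1ℚ)) +_)
                           (Σ-at N c (λ x → S * (coreResistance x c + 1ℚ)) c<N)))
        where
        split-at-c : ∀ b (a r : ℚ) → (a + ind b S + 1ℚ) * (r + 1ℚ) ≡ (a + 1ℚ) * (r + 1ℚ) + ind b (S * (r + 1ℚ))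
        split-at-c true  a r = solve 3 (λ a S r → (a :+ S :+ con 1ℚ) :* (r :+ con 1ℚ) := (a :+ con 1ℚ) :* (r :+ con 1ℚ) :+ S :* (r :+ con 1ℚ)) refl a S r
        split-at-c false a r = solve 2 (λ a r → (a :+ con 0ℚ :+ con 1ℚ) :* (r :+ con 1ℚ) := (a :+ con 1ℚ) :* (r :+ con 1ℚ) :+ con 0ℚ) refl a r

      degreeResistance-blocks : degreeResistance Gr resistance
        ≡ coreTerms + S * Σ[< N ] (coreResistance c)
          + S * (Σ[< N ] (λ x → (ℕtoℚ (coreDegree x) + 1ℚ) * (coreResistance x c + 1ℚ)) + S * (coreResistance c c + 1ℚ))
          + pendantTerms
      degreeResistance-blocks = begin
        Σ[< n ] (λ x → Σ[< n ] (term x))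
          ≡⟨ Σ-split N s (λ x → Σ[< n ] (term x)) ⟩
        Σ[< N ] (λ x → Σ[< n ] (term x)) + Σ[< s ] (λ i → Σ[< n ] (term (N ℕ.+ i)))
          ≡⟨ cong₂ _+_ (Σ-cong N row-core) (Σ-cong s row-pendant) ⟩
        Σ[< N ] (λ x → core-row x + S * ((degreeℚ x + 1ℚ) * (coreResistance x c + 1ℚ))) + pendantTerms
          ≡⟨ cong (_+ pendantTerms)
               (trans (Σ-distrib-+ N core-row (λ x → S * pendant-column x))
                      (cong₂ _+_ Σ-core-block (trans (Σ-*ˡ N S pendant-column) (cong (S *_) Σ-core-pendant-block)))) ⟩
        coreTerms + S * Σ[< N ] (coreResistance c)
          + S * (Σ[< N ] (λ x → (ℕtoℚ (coreDegree x) + 1ℚ) * (coreResistance x c + 1ℚ)) + S * (coreResistance c c + 1ℚ))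
          + pendantTerms ∎
        where
        core-row pendant-column : ℕ → ℚ
        core-row x = Σ[< N ] (λ y → ind (x <ᵇ y) ((degreeℚ x + degreeℚ y) * coreResistance x y))
        pendant-column x = (degreeℚ x + 1ℚ) * (coreResistance x c + 1ℚ)

    -- Only the pendant rows and columns depend on where the pendants are attached,
    -- and a pendant vertex is at resistance 1 + r(c,x) from a core vertex x.
    degreeResistance-formula : degreeResistance Gr resistance ≡ baseline + S * attachmentCost
    degreeResistance-formula = begin
      degreeResistance Gr resistance
        ≡⟨ degreeResistance-blocks ⟩
      coreTerms + S * Σ[< N ] (coreResistance c) + S * (Σ[< N ] (λ x → (D x + 1ℚ) * (coreResistance x c + 1ℚ)) + S * (coreResistance c c + 1ℚ))
        + pendantTerms
        ≡⟨ cong₂ (λ a b → coreTerms + S * Σ[< N ] (coreResistance c) + S * (a + S * (b + 1ℚ)) + pendantTerms)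
                 (trans (Σ-cong N (λ x _ → trans (cong (λ r → (D x + 1ℚ) * (r + 1ℚ)) (coreResistance-sym x c))
                                                  (solve 2 (λ d r → (d :+ con 1ℚ) :* (r :+ con 1ℚ) := (d :+ con 1ℚ) :* r :+ (d :+ con 1ℚ))
                                                         refl (D x) (coreResistance c x))))
                        (Σ-distrib-+ N (λ x → (D x + 1ℚ) * coreResistance c x) (λ x → D x + 1ℚ)))
                 (coreResistance-self c) ⟩
      coreTerms + S * Σ[< N ] (coreResistance c) + S * ((Σ[< N ] (λ x → (D x + 1ℚ) * coreResistance c x) + Σ[< N ] (λ x → D x + 1ℚ)) + S * (0ℚ + 1ℚ))
        + pendantTerms
        ≡⟨ solve 6 (λ t a b d s' p → t :+ s' :* a :+ s' :* ((b :+ d) :+ s' :* (con 0ℚ :+ con 1ℚ)) :+ p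
                                   := t :+ s' :* d :+ s' :* s' :+ p :+ s' :* (a :+ b))
                   refl coreTerms (Σ[< N ] (coreResistance c)) (Σ[< N ] (λ x → (D x + 1ℚ) * coreResistance c x))
                   (Σ[< N ] (λ x → D x + 1ℚ)) S pendantTerms ⟩
      baseline + S * (Σ[< N ] (coreResistance c) + Σ[< N ] (λ x → (D x + 1ℚ) * coreResistance c x))
        ≡⟨ cong (λ z → baseline + S * z)
                (trans (sym (Σ-distrib-+ N (coreResistance c) (λ x → (D x + 1ℚ) * coreResistance c x)))
                       (Σ-cong N (λ x _ → solve 2 (λ r d → r :+ (d :+ con 1ℚ) :* r := (d :+ con (ℕtoℚ 2)) :* r) refl (coreResistance c x) (D x)))) ⟩
      baseline + S * attachmentCost ∎
      where
      D : ℕ → ℚ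
      D x = ℕtoℚ (coreDegree x)

module Comparison (p' q' s k' : ℕ) (k<q : suc k' < suc (suc (suc q'))) where

  open import Data.Nat as ℕ using (_∸_; _≤_; s≤s; _⊓_)
  import Data.Nat.Properties as ℕ
  open import Data.Rational using (ℚ; 0ℚ; 1ℚ; _+_; _-_; _*_; Positive)
  open import Data.Rational.Properties
  open import Data.Rational.Solver using (module +-*-Solver)
  open +-*-Solver
  open import Relation.Binary.PropositionalEquality
  open ≡-Reasoning
  open import Defs
  open NatCast
  open FiniteSums
  open CycleGreen

  module G₁ = DegreeResistanceFormula p' q' s 0
  open G₁ using (p; q; N; qPos; coreGreen; coreResistance; q⁻¹; weight)

  k u : ℕ
  k = suc k'
  u = uVertex p k

  module G₀ = DegreeResistanceFormula p' q' s u

  p≤u : p ≤ u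
  p≤u = s≤s (s≤s (subst (suc p' ≤_) (sym (ℕ.+-suc p' k')) (s≤s (ℕ.m≤m+n p' k'))))

  u<N : u < N
  u<N = s≤s (s≤s (ℕ.+-monoʳ-< p' k<q))

  qPos-u : qPos u ≡ k
  qPos-u = ℕ.m+n∸m≡n p' k

  -- u splits C_q into paths of k and d + 1 edges.
  d : ℕ
  d = suc (suc q') ∸ k

  k+d : k ℕ.+ d ≡ suc (suc q')
  k+d = ℕ.m+[n∸m]≡n (ℕ.≤-pred k<q)

  Δ : ℕ → ℚ
  Δ x = coreGreen u u - (1ℚ + 1ℚ) * coreGreen u x

  coreResistance-u : ∀ x → coreResistance u x ≡ coreResistance 0 x + Δ x
  coreResistance-u x = begin
    coreGreen u u - coreGreen x u - (coreGreen u x - coreGreen x x)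
      ≡⟨ cong (λ z → coreGreen u u - z - (coreGreen u x - coreGreen x x)) (G₁.coreGreen-sym x u) ⟩
    coreGreen u u - coreGreen u x - (coreGreen u x - coreGreen x x)
      ≡⟨ solve 3 (λ a b e → a :- b :- (b :- e) := con 0ℚ :- con 0ℚ :- (con 0ℚ :- e) :+ (a :- (con 1ℚ :+ con 1ℚ) :* b))
                 refl (coreGreen u u) (coreGreen u x) (coreGreen x x) ⟩
    0ℚ - 0ℚ - (0ℚ - coreGreen x x) + Δ x
      ≡⟨ cong₂ (λ a b → a - b - (a - coreGreen x x) + Δ x) (sym (G₁.coreGreen-wˡ 0)) (sym (G₁.coreGreen-wʳ x)) ⟩
    coreGreen 0 0 - coreGreen x 0 - (coreGreen 0 0 - coreGreen x x) + Δ x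
      ≡⟨ cong (λ z → coreGreen 0 0 - coreGreen x 0 - (z - coreGreen x x) + Δ x) (trans (G₁.coreGreen-wˡ 0) (sym (G₁.coreGreen-wˡ x))) ⟩
    coreResistance 0 x + Δ x ∎

  attachmentCost-shift : G₀.attachmentCost ≡ G₁.attachmentCost + Σ[< N ] (λ x → weight x * Δ x)
  attachmentCost-shift =
    trans (Σ-cong N (λ x _ → trans (cong (weight x *_) (coreResistance-u x))
                                   (*-distribˡ-+ (weight x) (coreResistance 0 x) (Δ x))))
          (Σ-distrib-+ N (λ x → weight x * coreResistance 0 x) (λ x → weight x * Δ x))

  G : ℚ
  G = coreGreen u u

  ΣG : ℚ
  ΣG = Σ[< N ] (coreGreen u)

  Σ-weight-Δ : Σ[< N ] (λ x → weight x * Δ x) ≡ (ℕtoℚ 6 + ℕtoℚ 4 * ℕtoℚ (N ∸ 1)) * G - ℕtoℚ 8 * ΣG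
  Σ-weight-Δ = begin
    Σ[< N ] (λ x → weight x * Δ x)
      ≡⟨ Σ-suc (N ∸ 1) (λ x → weight x * Δ x) ⟩
    (ℕtoℚ 4 + ℕtoℚ 2) * Δ 0 + Σ[< N ∸ 1 ] (λ x → (ℕtoℚ 2 + ℕtoℚ 2) * Δ (suc x))
      ≡⟨ cong₂ _+_ (cong (λ z → (ℕtoℚ 4 + ℕtoℚ 2) * (G - (1ℚ + 1ℚ) * z)) (G₁.coreGreen-wʳ u))
                   (trans (Σ-cong (N ∸ 1) (λ x _ → solve 2 (λ g y → (con (ℕtoℚ 2) :+ con (ℕtoℚ 2)) :* (g :- (con 1ℚ :+ con 1ℚ) :* y)
                                                                   := con (ℕtoℚ 4) :* g :- con (ℕtoℚ 8) :* y)
                                                         refl G (coreGreen u (suc x))))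
                          (trans (Σ-distrib-diff (N ∸ 1) (λ _ → ℕtoℚ 4 * G) (λ x → ℕtoℚ 8 * coreGreen u (suc x)))
                                 (cong₂ _-_ (Σ-const (N ∸ 1) (ℕtoℚ 4 * G)) (Σ-*ˡ (N ∸ 1) (ℕtoℚ 8) (λ x → coreGreen u (suc x)))))) ⟩
    (ℕtoℚ 4 + ℕtoℚ 2) * (G - (1ℚ + 1ℚ) * 0ℚ) + (ℕtoℚ (N ∸ 1) * (ℕtoℚ 4 * G) - ℕtoℚ 8 * ΣG⁺)
      ≡⟨ solve 3 (λ g m σ → (con (ℕtoℚ 4) :+ con (ℕtoℚ 2)) :* (g :- (con 1ℚ :+ con 1ℚ) :* con 0ℚ) :+ (m :* (con (ℕtoℚ 4) :* g) :- con (ℕtoℚ 8) :* σ)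
                         := (con (ℕtoℚ 6) :+ con (ℕtoℚ 4) :* m) :* g :- con (ℕtoℚ 8) :* σ)
                 refl G (ℕtoℚ (N ∸ 1)) ΣG⁺ ⟩
    (ℕtoℚ 6 + ℕtoℚ 4 * ℕtoℚ (N ∸ 1)) * G - ℕtoℚ 8 * ΣG⁺
      ≡⟨ cong (λ z → (ℕtoℚ 6 + ℕtoℚ 4 * ℕtoℚ (N ∸ 1)) * G - ℕtoℚ 8 * z) (sym ΣG≡ΣG⁺) ⟩
    (ℕtoℚ 6 + ℕtoℚ 4 * ℕtoℚ (N ∸ 1)) * G - ℕtoℚ 8 * ΣG ∎
    where
    ΣG⁺ : ℚ
    ΣG⁺ = Σ[< N ∸ 1 ] (λ x → coreGreen u (suc x))
    ΣG≡ΣG⁺ : ΣG ≡ ΣG⁺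
    ΣG≡ΣG⁺ = trans (Σ-suc (N ∸ 1) (coreGreen u)) (trans (cong (_+ ΣG⁺) (G₁.coreGreen-wʳ u)) (+-identityˡ ΣG⁺))

  K D′ P′ : ℚ
  K = ℕtoℚ k
  D′ = ℕtoℚ d
  P′ = ℕtoℚ p'

  triangular-k triangular-q : ℚ
  triangular-k = Σ[< k ] (λ j → ℕtoℚ (suc j))
  triangular-q = Σ[< k ℕ.+ d ] (λ j → ℕtoℚ (suc j))

  ΣG-value : ΣG ≡ (triangular-k + D′ * K) - (K * q⁻¹) * triangular-q
  ΣG-value = begin
    Σ[< N ] (coreGreen u)
      ≡⟨ cong (λ z → Σ[< z ] (coreGreen u)) N≡p+q∸1 ⟩
    Σ[< p ℕ.+ suc (suc q') ] (coreGreen u)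
      ≡⟨ Σ-split p (suc (suc q')) (coreGreen u) ⟩
    Σ[< p ] (coreGreen u) + Σ[< suc (suc q') ] (λ j → coreGreen u (p ℕ.+ j))
      ≡⟨ cong₂ _+_ (trans (Σ-cong p (λ x x<p → G₁.coreGreen-qp p≤u x<p)) (Σ-zero p))
                   (Σ-cong (suc (suc q')) (λ j _ → trans (G₁.coreGreen-qq p≤u (ℕ.m≤m+n p j)) (cong₂ (cycleGreen q⁻¹) qPos-u (qPos-p+ j)))) ⟩
    0ℚ + Σ[< suc (suc q') ] (λ j → cycleGreen q⁻¹ k (suc j))
      ≡⟨ trans (+-identityˡ _) (cong (λ z → Σ[< z ] (λ j → cycleGreen q⁻¹ k (suc j))) (sym k+d)) ⟩
    Σ[< k ℕ.+ d ] (λ j → cycleGreen q⁻¹ k (suc j))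
      ≡⟨ Σ-cong (k ℕ.+ d) (λ j _ → solve 4 (λ a b c v → a :- b :* c :* v := a :- (b :* v) :* c) refl (ℕtoℚ (k ⊓ suc j)) K (ℕtoℚ (suc j)) q⁻¹) ⟩
    Σ[< k ℕ.+ d ] (λ j → ℕtoℚ (k ⊓ suc j) - (K * q⁻¹) * ℕtoℚ (suc j))
      ≡⟨ trans (Σ-distrib-diff (k ℕ.+ d) (λ j → ℕtoℚ (k ⊓ suc j)) (λ j → (K * q⁻¹) * ℕtoℚ (suc j)))
               (cong₂ _-_ (Σ-⊓ k d) (Σ-*ˡ (k ℕ.+ d) (K * q⁻¹) (λ j → ℕtoℚ (suc j)))) ⟩
    (triangular-k + D′ * K) - (K * q⁻¹) * triangular-q ∎
    where
    N≡p+q∸1 : N ≡ p ℕ.+ suc (suc q')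
    N≡p+q∸1 = cong (λ z → suc (suc z)) (ℕ.+-suc p' (suc (suc q')))
    qPos-p+ : ∀ j → qPos (p ℕ.+ j) ≡ suc j
    qPos-p+ j = trans (cong (_∸ (p ∸ 1)) (sym (ℕ.+-suc (p ∸ 1) j))) (ℕ.m+n∸m≡n (p ∸ 1) (suc j))

  -- (4p - 2)·k(q - k)/q, written with p = p' + 3 and q - k = d + 1.
  increase : ℚ
  increase = (ℕtoℚ 10 + ℕtoℚ 4 * P′) * K * (1ℚ + D′) * q⁻¹

  Σ-weight-Δ≡increase : Σ[< N ] (λ x → weight x * Δ x) ≡ increase
  Σ-weight-Δ≡increase = begin
    Σ[< N ] (λ x → weight x * Δ x)
      ≡⟨ Σ-weight-Δ ⟩
    (ℕtoℚ 6 + ℕtoℚ 4 * ℕtoℚ (N ∸ 1)) * G - ℕtoℚ 8 * ΣG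
      ≡⟨ cong₂ (λ a b → (ℕtoℚ 6 + ℕtoℚ 4 * a) * b - ℕtoℚ 8 * ΣG) N∸1≡ G≡ ⟩
    (ℕtoℚ 6 + ℕtoℚ 4 * (1ℚ + (P′ + Q))) * (K - K * K * q⁻¹) - ℕtoℚ 8 * ΣG
      ≡⟨ cong (λ z → (ℕtoℚ 6 + ℕtoℚ 4 * (1ℚ + (P′ + Q))) * (K - K * K * q⁻¹) - ℕtoℚ 8 * z) ΣG-value ⟩
    (ℕtoℚ 6 + ℕtoℚ 4 * (1ℚ + (P′ + Q))) * (K - K * K * q⁻¹) - ℕtoℚ 8 * ((triangular-k + D′ * K) - (K * q⁻¹) * triangular-q)
      ≡⟨ solve 6 (λ P K D v tk tq →
           (con (ℕtoℚ 6) :+ con (ℕtoℚ 4) :* (con 1ℚ :+ (P :+ (con 1ℚ :+ (K :+ D))))) :* (K :- K :* K :* v)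
             :- con (ℕtoℚ 8) :* ((tk :+ D :* K) :- (K :* v) :* tq)
           := (con (ℕtoℚ 10) :+ con (ℕtoℚ 4) :* P) :* K :* (con 1ℚ :+ D) :* v
              :+ (con 1ℚ :- (con 1ℚ :+ (K :+ D)) :* v) :* (K :* (con (ℕtoℚ 4) :* P :+ con (ℕtoℚ 10) :- con (ℕtoℚ 4) :* D))
              :+ con (ℕtoℚ 4) :* (K :* (con 1ℚ :+ K) :- con (ℕtoℚ 2) :* tk)
              :- con (ℕtoℚ 4) :* K :* v :* ((K :+ D) :* (con 1ℚ :+ (K :+ D)) :- con (ℕtoℚ 2) :* tq))
                 refl P′ K D′ q⁻¹ triangular-k triangular-q ⟩
    increase + (1ℚ - Q * q⁻¹) * R + ℕtoℚ 4 * (K * (1ℚ + K) - ℕtoℚ 2 * triangular-k)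
      - ℕtoℚ 4 * K * q⁻¹ * ((K + D′) * Q - ℕtoℚ 2 * triangular-q)
      ≡⟨ cong₃ (λ a b c → increase + (1ℚ - a) * R + ℕtoℚ 4 * (K * (1ℚ + K) - b) - ℕtoℚ 4 * K * q⁻¹ * ((K + D′) * Q - c))
               Q*q⁻¹≡1 (trans (Σ-triangular k) (cong (K *_) (ℕtoℚ-suc k))) 2triangular-q ⟩
    increase + (1ℚ - 1ℚ) * R + ℕtoℚ 4 * (K * (1ℚ + K) - K * (1ℚ + K)) - ℕtoℚ 4 * K * q⁻¹ * ((K + D′) * Q - (K + D′) * Q)
      ≡⟨ solve 6 (λ t r a b c e → t :+ (con 1ℚ :- con 1ℚ) :* r :+ con (ℕtoℚ 4) :* (a :- a) :- con (ℕtoℚ 4) :* b :* c :* (e :- e) := t)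
                 refl increase R (K * (1ℚ + K)) K q⁻¹ ((K + D′) * Q) ⟩
    increase ∎
    where
    Q : ℚ
    Q = 1ℚ + (K + D′)
    R : ℚ
    R = K * (ℕtoℚ 4 * P′ + ℕtoℚ 10 - ℕtoℚ 4 * D′)
    cong₃ : ∀ {a a′ b b′ c c′ : ℚ} (f : ℚ → ℚ → ℚ → ℚ) → a ≡ a′ → b ≡ b′ → c ≡ c′ → f a b c ≡ f a′ b′ c′
    cong₃ f refl refl refl = refl
    q≡Q : ℕtoℚ q ≡ Q
    q≡Q = trans (cong (λ z → ℕtoℚ (suc z)) (sym k+d)) (trans (ℕtoℚ-suc (k ℕ.+ d)) (cong (1ℚ +_) (ℕtoℚ-+ k d)))
    N∸1≡ : ℕtoℚ (N ∸ 1) ≡ 1ℚ + (P′ + Q)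
    N∸1≡ = trans (ℕtoℚ-suc (p' ℕ.+ q)) (cong (1ℚ +_) (trans (ℕtoℚ-+ p' q) (cong (P′ +_) q≡Q)))
    Q*q⁻¹≡1 : Q * q⁻¹ ≡ 1ℚ
    Q*q⁻¹≡1 = trans (cong (_* q⁻¹) (sym q≡Q)) (G₁.*-inv-suc (suc (suc q')))
    G≡ : G ≡ K - K * K * q⁻¹
    G≡ = trans (G₁.coreGreen-qq p≤u p≤u)
               (trans (cong₂ (cycleGreen q⁻¹) qPos-u qPos-u) (cong (λ z → ℕtoℚ z - K * K * q⁻¹) (ℕ.⊓-idem k)))
    2triangular-q : ℕtoℚ 2 * triangular-q ≡ (K + D′) * Q
    2triangular-q = trans (Σ-triangular (k ℕ.+ d))
                          (cong₂ _*_ (ℕtoℚ-+ k d) (trans (ℕtoℚ-suc (k ℕ.+ d)) (cong (1ℚ +_) (ℕtoℚ-+ k d))))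

  increase-positive : 0ℚ Data.Rational.< increase
  increase-positive =
    positive⁻¹ increase {{pos*pos⇒pos (a * K * b) {{pos*pos⇒pos (a * K) {{pos*pos⇒pos a {{4p-2-positive}} K {{ℕtoℚ-suc-positive k'}}}}
                                                                b {{q-k-positive}}}}
                                      q⁻¹ {{q⁻¹-positive}}}}
    where
    a b : ℚ
    a = ℕtoℚ 10 + ℕtoℚ 4 * P′
    b = 1ℚ + D′
    4p-2-positive : Positive (ℕtoℚ 10 + ℕtoℚ 4 * P′)
    4p-2-positive = subst Positive (trans (ℕtoℚ-+ 10 (4 ℕ.* p')) (cong (ℕtoℚ 10 +_) (ℕtoℚ-* 4 p')))
                          (ℕtoℚ-suc-positive (9 ℕ.+ 4 ℕ.* p'))
    q-k-positive : Positive (1ℚ + D′)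
    q-k-positive = subst Positive (ℕtoℚ-suc d) (ℕtoℚ-suc-positive d)
    q⁻¹-positive : Positive q⁻¹
    q⁻¹-positive = 1/pos⇒pos (ℕtoℚ q) {{ℕtoℚ-suc-positive (suc (suc q'))}}

  attachmentCost-increases : G₁.attachmentCost Data.Rational.< G₀.attachmentCost
  attachmentCost-increases =
    subst (G₁.attachmentCost Data.Rational.<_) (sym (trans attachmentCost-shift (cong (G₁.attachmentCost +_) Σ-weight-Δ≡increase)))
      (subst (Data.Rational._< G₁.attachmentCost + increase) (+-identityʳ _) (+-monoʳ-< G₁.attachmentCost increase-positive))

lemma2p5 : (p q s k : ℕ) → 3 ≤ p → 3 ≤ q → 1 ≤ s → 1 ≤ k → k < q →
    Σ (ℕ → ℕ → ℚ) (IsResistanceDistance (G₀ p q s k))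
    × Σ (ℕ → ℕ → ℚ) (IsResistanceDistance (G₁ p q s))
    × ((R₀ R₁ : ℕ → ℕ → ℚ) →
         IsResistanceDistance (G₀ p q s k) R₀ →
         IsResistanceDistance (G₁ p q s) R₁ →
         degreeResistance (G₁ p q s) R₁ Q.< degreeResistance (G₀ p q s k) R₀)
lemma2p5 (suc (suc (suc p'))) (suc (suc (suc q'))) (suc s') (suc k')
         (s≤s (s≤s (s≤s z≤n))) (s≤s (s≤s (s≤s z≤n))) (s≤s z≤n) (s≤s z≤n) k<q =
  (G₀.resistance , G₀.resistance-isResistanceDistance u<N) ,
  (G₁.resistance , G₁.resistance-isResistanceDistance w<N) ,
  λ R₀ R₁ isR₀ isR₁ → begin-strict
    degreeResistance G₁.Gr R₁
      ≡⟨ degreeResistance-unique G₁.Gr (G₁.connected w<N) isR₁ (G₁.resistance-isResistanceDistance w<N) ⟩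
    degreeResistance G₁.Gr G₁.resistance
      ≡⟨ G₁.degreeResistance-formula w<N ⟩
    G₁.baseline Q.+ G₁.S Q.* G₁.attachmentCost
      <⟨ +-monoʳ-< G₁.baseline (*-monoʳ-<-pos G₁.S {{ℕtoℚ-suc-positive s'}} attachmentCost-increases) ⟩
    G₀.baseline Q.+ G₀.S Q.* G₀.attachmentCost
      ≡⟨ sym (G₀.degreeResistance-formula u<N) ⟩
    degreeResistance G₀.Gr G₀.resistance
      ≡⟨ degreeResistance-unique G₀.Gr (G₀.connected u<N) (G₀.resistance-isResistanceDistance u<N) isR₀ ⟩
    degreeResistance G₀.Gr R₀ ∎
  where
  open NatCast using (ℕtoℚ-suc-positive)
  open Resistance using (degreeResistance-unique)
  open Comparison p' q' (suc s') k' k<q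
  open ≤-Reasoning
  w<N : 0 < G₁.N
  w<N = s≤s z≤n
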